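{- The computational $\lambda\Box$-calculus is strongly normalizing with respect to $\to_c$: no well-typed term admits an infinite $\to_c$-reduction sequence.
   Context: Types: $\sigma ::= p \mid \sigma\supset\sigma\mid\Box\sigma$. Terms (box bodies restricted to values): $M::=c\mid x\mid\lambda x^\sigma.M\mid MM\mid\mathbf{box}_{x_1^{\sigma_1},\dots,x_n^{\sigma_n}}(M_1,\dots,M_n;V)\mid \mathrm{let}\ x=N\ \mathrm{in}\ M$. In a box term the $x_i$ are bound in the body, and its free variables are those of the $M_i$. In $\mathrm{let}\ x=N\ \mathrm{in}\ M$ the variable $x$ is bound in $M$. Typing rules: - the usual rules for constants, variables, $\lambda$ and application; - from $x_1:\sigma_1,\dots,x_n:\sigma_n\vdash M:\tau$ and $\Gamma\vdash N_i:\Box\sigma_i$ infer $\Gamma\vdash\mathbf{box}_{\vec x}(\vec N;M):\Box\tau$; - from $\Gamma\vdash N:\sigma$ and $\Gamma,x:\sigma\vdash M:\tau$ infer $\Gamma\vdash\mathrm{let}\ x=N\ \mathrm{in}\ M:\tau$. Values: $V::=c\mid x\mid\lambda x.M\mid\mathbf{box}_{\vec x}(V_1,\dots,V_n;M)$; a non-value is a term that is not a value. Simple evaluation contexts: $C::=[\,]M\mid V[\,]\mid\mathbf{box}_{\vec x}(V_1,\dots,V_k,[\,],M_1,\dots,M_m;M)$. $\to_c$ is the closure under term contexts of the following rules (new bound variables fresh, $|\vec x|$ the length of a sequence): - $\mathrm{let}\ x=M\ \mathrm{in}\ x\to M$; - $\mathrm{let}\ x=V\ \mathrm{in}\ M\to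 M[x:=V]$; - $(\lambda x.M)V\to M[x:=V]$; - $\lambda x.Vx\to V$ if $x\notin FV(V)$; - $\mathrm{let}\ x=(\mathrm{let}\ y=L\ \mathrm{in}\ N)\ \mathrm{in}\ M\to\mathrm{let}\ y=L\ \mathrm{in}\ \mathrm{let}\ x=N\ \mathrm{in}\ M$ if $y\notin FV(M)$; - $C[A]\to\mathrm{let}\ x=A\ \mathrm{in}\ C[x]$ for $A$ a non-value; - $\mathbf{box}_x(M;x)\to M$; - $\mathbf{box}_{\vec w,x,\vec z}(\vec W,\mathbf{box}_{\vec y}(\vec N;V),\vec P;M)\to\mathbf{box}_{\vec w,\vec y,\vec z}(\vec W,\vec N,\vec P;M[x:=V])$, with $\vec W$ values and $|\vec w|=|\vec W|$. -}

module Defs where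

open import Data.Nat using (ℕ)
open import Data.List using (List; []; _∷_; _++_)
open import Relation.Nullary using (¬_)

infixr 7 _⊃_
data Ty : Set where
  atom : ℕ → Ty
  _⊃_  : Ty → Ty → Ty
  □_   : Ty → Ty

Ctx : Set
Ctx = List Ty

infix 4 _∋_
data _∋_ : Ctx → Ty → Set where
  here  : ∀ {Γ σ} → (σ ∷ Γ) ∋ σ
  there : ∀ {Γ σ τ} → Γ ∋ σ → (τ ∷ Γ) ∋ σ

module _ (K : Ty → Set) where

  -- Args Γ Δ : a sequence of terms N_i with Γ ⊢ N_i : □ σ_i where Δ = σ_1 … σ_n.
  -- The box body lives in context Δ only (x_1 : σ_1 … x_n : σ_n) and must be a value.
  data Tm     : Ctx → Ty → Set
  data Args   : Ctx → Ctx → Set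
  data Value  : ∀ {Γ σ} → Tm Γ σ → Set
  data Values : ∀ {Γ Δ} → Args Γ Δ → Set

  data Tm where
    con  : ∀ {Γ σ} → K σ → Tm Γ σ
    var  : ∀ {Γ σ} → Γ ∋ σ → Tm Γ σ
    lam  : ∀ {Γ σ τ} → Tm (σ ∷ Γ) τ → Tm Γ (σ ⊃ τ)
    app  : ∀ {Γ σ τ} → Tm Γ (σ ⊃ τ) → Tm Γ σ → Tm Γ τ
    box  : ∀ {Γ Δ τ} → Args Γ Δ → (M : Tm Δ τ) → Value M → Tm Γ (□ τ)
    lett : ∀ {Γ σ τ} → Tm Γ σ → Tm (σ ∷ Γ) τ → Tm Γ τ

  data Args where
    []  : ∀ {Γ} → Args Γ []
    _∷_ : ∀ {Γ σ Δ} → Tm Γ (□ σ) → Args Γ Δ → Args Γ (σ ∷ Δ)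

  data Value where
    vcon : ∀ {Γ σ} {c : K σ} → Value (con {Γ} c)
    vvar : ∀ {Γ σ} {x : Γ ∋ σ} → Value (var x)
    vlam : ∀ {Γ σ τ} {M : Tm (σ ∷ Γ) τ} → Value (lam M)
    vbox : ∀ {Γ Δ τ} {Ns : Args Γ Δ} {M : Tm Δ τ} {v : Value M} →
           Values Ns → Value (box Ns M v)

  data Values where
    []  : ∀ {Γ} → Values ([] {Γ})
    _∷_ : ∀ {Γ σ Δ} {N : Tm Γ (□ σ)} {Ns : Args Γ Δ} →
          Value N → Values Ns → Values (N ∷ Ns)

  infixr 5 _++ᵃ_
  _++ᵃ_ : ∀ {Γ Δ₁ Δ₂} → Args Γ Δ₁ → Args Γ Δ₂ → Args Γ (Δ₁ ++ Δ₂)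
  [] ++ᵃ Ms = Ms
  (N ∷ Ns) ++ᵃ Ms = N ∷ (Ns ++ᵃ Ms)

  Ren : Ctx → Ctx → Set
  Ren Γ Δ = ∀ {σ} → Γ ∋ σ → Δ ∋ σ

  liftR : ∀ {Γ Δ τ} → Ren Γ Δ → Ren (τ ∷ Γ) (τ ∷ Δ)
  liftR ρ here      = here
  liftR ρ (there x) = there (ρ x)

  ren     : ∀ {Γ Δ σ} → Ren Γ Δ → Tm Γ σ → Tm Δ σ
  renArgs : ∀ {Γ Δ Θ} → Ren Γ Δ → Args Γ Θ → Args Δ Θ
  ren ρ (con c)      = con c
  ren ρ (var x)      = var (ρ x)
  ren ρ (lam M)      = lam (ren (liftR ρ) M)
  ren ρ (app M N)    = app (ren ρ M) (ren ρ N)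
  ren ρ (box Ns M v) = box (renArgs ρ Ns) M v
  ren ρ (lett N M)   = lett (ren ρ N) (ren (liftR ρ) M)
  renArgs ρ []       = []
  renArgs ρ (N ∷ Ns) = ren ρ N ∷ renArgs ρ Ns

  wk : ∀ {Γ σ τ} → Tm Γ σ → Tm (τ ∷ Γ) σ
  wk = ren there

  wkArgs : ∀ {Γ Δ τ} → Args Γ Δ → Args (τ ∷ Γ) Δ
  wkArgs = renArgs there

  Sub : Ctx → Ctx → Set
  Sub Γ Δ = ∀ {σ} → Γ ∋ σ → Tm Δ σ

  liftS : ∀ {Γ Δ τ} → Sub Γ Δ → Sub (τ ∷ Γ) (τ ∷ Δ)
  liftS s here      = var here
  liftS s (there x) = wk (s x)

  sub     : ∀ {Γ Δ σ} → Sub Γ Δ → Tm Γ σ → Tm Δ σ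
  subArgs : ∀ {Γ Δ Θ} → Sub Γ Δ → Args Γ Θ → Args Δ Θ
  sub s (con c)      = con c
  sub s (var x)      = s x
  sub s (lam M)      = lam (sub (liftS s) M)
  sub s (app M N)    = app (sub s M) (sub s N)
  sub s (box Ns M v) = box (subArgs s Ns) M v
  sub s (lett N M)   = lett (sub s N) (sub (liftS s) M)
  subArgs s []       = []
  subArgs s (N ∷ Ns) = sub s N ∷ subArgs s Ns

  single : ∀ {Γ σ} → Tm Γ σ → Sub (σ ∷ Γ) Γ
  single V here      = V
  single V (there x) = var x

  _[_] : ∀ {Γ σ τ} → Tm (σ ∷ Γ) τ → Tm Γ σ → Tm Γ τ
  M [ V ] = sub (single V) M

  injectˡ : ∀ {Γ σ} Δ → Γ ∋ σ → (Γ ++ Δ) ∋ σ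
  injectˡ Δ here      = here
  injectˡ Δ (there x) = there (injectˡ Δ x)

  raise : ∀ {Δ σ} Γ → Δ ∋ σ → (Γ ++ Δ) ∋ σ
  raise []      x = x
  raise (τ ∷ Γ) x = there (raise Γ x)

  -- substitution used by box-merging:
  -- context  w⃗ , x , z⃗   ↦   w⃗ , y⃗ , z⃗   with  x := V  (V in context y⃗)
  mergeSub : ∀ Δw {Δy Δz σ} → Tm Δy σ → Sub (Δw ++ σ ∷ Δz) (Δw ++ Δy ++ Δz)
  mergeSub []       {Δy} {Δz} V here      = ren (injectˡ Δz) V
  mergeSub []       {Δy} {Δz} V (there x) = var (raise Δy x)
  mergeSub (ρ ∷ Δw)             V here      = var here
  mergeSub (ρ ∷ Δw)             V (there x) = wk (mergeSub Δw V x)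

  infix 4 _→c_ _→cᵃ_
  data _→c_ : ∀ {Γ σ} → Tm Γ σ → Tm Γ σ → Set
  data _→cᵃ_ : ∀ {Γ Δ} → Args Γ Δ → Args Γ Δ → Set

  data _→c_ where
    let-var   : ∀ {Γ σ} {M : Tm Γ σ} → lett M (var here) →c M
    let-val   : ∀ {Γ σ τ} {V : Tm Γ σ} {M : Tm (σ ∷ Γ) τ} →
                Value V → lett V M →c M [ V ]
    beta      : ∀ {Γ σ τ} {M : Tm (σ ∷ Γ) τ} {V : Tm Γ σ} →
                Value V → app (lam M) V →c M [ V ]
    -- λx. V x → V   (x ∉ FV(V) : V is a weakening)
    eta       : ∀ {Γ σ τ} {V : Tm Γ (σ ⊃ τ)} →
                Value V → lam (app (wk V) (var here)) →c V
    -- let x = (let y = L in N) in M → let y = L in let x = N in M   (y ∉ FV(M))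
    let-assoc : ∀ {Γ ρ σ τ} {L : Tm Γ ρ} {N : Tm (ρ ∷ Γ) σ} {M : Tm (σ ∷ Γ) τ} →
                lett (lett L N) M →c lett L (lett N (ren (liftR there) M))
    lift-appˡ : ∀ {Γ σ τ} {A : Tm Γ (σ ⊃ τ)} {M : Tm Γ σ} →
                ¬ Value A → app A M →c lett A (app (var here) (wk M))
    lift-appʳ : ∀ {Γ σ τ} {V : Tm Γ (σ ⊃ τ)} {A : Tm Γ σ} →
                Value V → ¬ Value A → app V A →c lett A (app (wk V) (var here))
    lift-box  : ∀ {Γ Δ₁ Δ₂ ρ τ} {Vs : Args Γ Δ₁} {A : Tm Γ (□ ρ)} {Ms : Args Γ Δ₂}
                  {M : Tm (Δ₁ ++ ρ ∷ Δ₂) τ} {v : Value M} →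
                Values Vs → ¬ Value A →
                box (Vs ++ᵃ (A ∷ Ms)) M v →c
                lett A (box (wkArgs Vs ++ᵃ (var here ∷ wkArgs Ms)) M v)
    box-var   : ∀ {Γ σ} {M : Tm Γ (□ σ)} → box (M ∷ []) (var here) vvar →c M
    box-merge : ∀ {Γ Δw Δy Δz σ τ} {Ws : Args Γ Δw} {Ns : Args Γ Δy} {V : Tm Δy σ}
                  {vV : Value V} {Ps : Args Γ Δz} {M : Tm (Δw ++ σ ∷ Δz) τ}
                  {vM : Value M} {vM' : Value (sub (mergeSub Δw V) M)} →
                Values Ws →
                box (Ws ++ᵃ (box Ns V vV ∷ Ps)) M vM →c
                box (Ws ++ᵃ (Ns ++ᵃ Ps)) (sub (mergeSub Δw V) M) vM'
    ξ-lam     : ∀ {Γ σ τ} {M M' : Tm (σ ∷ Γ) τ} → M →c M' → lam M →c lam M'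
    ξ-appˡ    : ∀ {Γ σ τ} {M M' : Tm Γ (σ ⊃ τ)} {N : Tm Γ σ} →
                M →c M' → app M N →c app M' N
    ξ-appʳ    : ∀ {Γ σ τ} {M : Tm Γ (σ ⊃ τ)} {N N' : Tm Γ σ} →
                N →c N' → app M N →c app M N'
    ξ-letˡ    : ∀ {Γ σ τ} {N N' : Tm Γ σ} {M : Tm (σ ∷ Γ) τ} →
                N →c N' → lett N M →c lett N' M
    ξ-letʳ    : ∀ {Γ σ τ} {N : Tm Γ σ} {M M' : Tm (σ ∷ Γ) τ} →
                M →c M' → lett N M →c lett N M'
    ξ-box-arg : ∀ {Γ Δ τ} {Ns Ns' : Args Γ Δ} {M : Tm Δ τ} {v : Value M} →
                Ns →cᵃ Ns' → box Ns M v →c box Ns' M v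
    ξ-box-body : ∀ {Γ Δ τ} {Ns : Args Γ Δ} {M M' : Tm Δ τ} {v : Value M} {v' : Value M'} →
                M →c M' → box Ns M v →c box Ns M' v'

  data _→cᵃ_ where
    hd : ∀ {Γ σ Δ} {N N' : Tm Γ (□ σ)} {Ns : Args Γ Δ} → N →c N' → (N ∷ Ns) →cᵃ (N' ∷ Ns)
    tl : ∀ {Γ σ Δ} {N : Tm Γ (□ σ)} {Ns Ns' : Args Γ Δ} → Ns →cᵃ Ns' → (N ∷ Ns) →cᵃ (N ∷ Ns')

-- The proof is by ⊤⊤-lifting (Lindley–Stark), adapted to let-bound evaluation stacks.
-- A stack S is a sequence of frames  let x = [ ] in C  and  box(W⃗, [ ], M⃗; B)  with the
-- W⃗ values; a stack of type σ is reducible when it sends every reducible value of type σ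
-- to a strongly normalising term, and a term is reducible when every reducible stack
-- does (both under all renamings).  A value of type □τ is reducible when its realisation,
-- the fully merged body obtained by substituting the realisations of the argument values
-- into the body, is a reducible value of type τ.
--
-- The heart of the argument is a family of backward closure properties: if the contractum
-- of a let-value, β or let-lifting redex inside a stack is strongly normalising, so is the
-- redex.  They are proved by analysing every step of  plug S X  with X a non-value: it is
-- inside X, a step of the stack alone, or one of two interactions of X with the innermost
-- frame (let-associativity and box-merging).  Once the contractum is a value, lifting it
-- out of a box frame is no longer a step; that case is reduced to a stack with one box
-- frame fewer, which is the outer induction.  Box values are strongly normalising because
-- each of their steps either simulates steps of the realisation or merges boxes, which
-- decreases the number of box nodes.

module Submission where

open import Defs using (Ty; atom; _⊃_; □_; Ctx; _∋_; here; there;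
                        con; var; lam; app; box; lett; []; _∷_;
                        vcon; vvar; vlam; vbox;
                        let-var; let-val; beta; eta; let-assoc; lift-appˡ; lift-appʳ; lift-box;
                        box-var; box-merge; ξ-lam; ξ-appˡ; ξ-appʳ; ξ-letˡ; ξ-letʳ;
                        ξ-box-arg; ξ-box-body; hd; tl)
import Defs as D
open import Data.Empty using (⊥-elim)
open import Data.List using ([]; _∷_; _++_)
open import Data.Nat using (ℕ; suc; _+_; _≤_; _<_; s≤s)
open import Data.Nat.Induction using (<-wellFounded)
open import Data.Nat.Properties
  using (≤-refl; ≤-trans; <-≤-trans; <⇒≤; n≤1+n; n<1+n; m≤m+n; +-assoc; +-mono-≤; +-mono-≤-<)
open import Data.Product using (Σ; _×_; _,_; proj₁; proj₂)
open import Data.Sum using (_⊎_; inj₁; inj₂)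
open import Function using (_∘_; flip)
open import Induction.WellFounded using (Acc; acc)
open import Relation.Binary.Construct.Closure.ReflexiveTransitive
  using (Star; _◅_; _◅◅_; gmap) renaming (ε to ε*)
open import Relation.Binary.PropositionalEquality
  using (_≡_; refl; sym; trans; cong; cong₂; subst; subst₂)
open import Relation.Nullary using (¬_; Dec; yes; no)

module StrongNormalisation (K : Ty → Set) where

  Tm : Ctx → Ty → Set
  Tm = D.Tm K

  Args : Ctx → Ctx → Set
  Args = D.Args K

  Value : ∀ {Γ σ} → Tm Γ σ → Set
  Value = D.Value K

  Values : ∀ {Γ Δ} → Args Γ Δ → Set
  Values = D.Values K

  Ren Sub : Ctx → Ctx → Set
  Ren = D.Ren K
  Sub = D.Sub K

  liftR : ∀ {Γ Δ τ} → Ren Γ Δ → Ren (τ ∷ Γ) (τ ∷ Δ)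
  liftR = D.liftR K

  liftS : ∀ {Γ Δ τ} → Sub Γ Δ → Sub (τ ∷ Γ) (τ ∷ Δ)
  liftS = D.liftS K

  ren : ∀ {Γ Δ σ} → Ren Γ Δ → Tm Γ σ → Tm Δ σ
  ren = D.ren K

  renArgs : ∀ {Γ Δ Θ} → Ren Γ Δ → Args Γ Θ → Args Δ Θ
  renArgs = D.renArgs K

  wk : ∀ {Γ σ τ} → Tm Γ σ → Tm (τ ∷ Γ) σ
  wk = D.wk K

  wkArgs : ∀ {Γ Δ τ} → Args Γ Δ → Args (τ ∷ Γ) Δ
  wkArgs = D.wkArgs K

  sub : ∀ {Γ Δ σ} → Sub Γ Δ → Tm Γ σ → Tm Δ σ
  sub = D.sub K

  subArgs : ∀ {Γ Δ Θ} → Sub Γ Δ → Args Γ Θ → Args Δ Θ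
  subArgs = D.subArgs K

  single : ∀ {Γ σ} → Tm Γ σ → Sub (σ ∷ Γ) Γ
  single = D.single K

  _[_] : ∀ {Γ σ τ} → Tm (σ ∷ Γ) τ → Tm Γ σ → Tm Γ τ
  _[_] = D._[_] K

  _++ᵃ_ : ∀ {Γ Δ₁ Δ₂} → Args Γ Δ₁ → Args Γ Δ₂ → Args Γ (Δ₁ ++ Δ₂)
  _++ᵃ_ = D._++ᵃ_ K

  injectˡ : ∀ {Γ σ} Δ → Γ ∋ σ → (Γ ++ Δ) ∋ σ
  injectˡ = D.injectˡ K

  raise : ∀ {Δ σ} Γ → Δ ∋ σ → (Γ ++ Δ) ∋ σ
  raise = D.raise K

  mergeSub : ∀ Δw {Δy Δz σ} → Tm Δy σ → Sub (Δw ++ σ ∷ Δz) (Δw ++ Δy ++ Δz)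
  mergeSub = D.mergeSub K

  _→c_ : ∀ {Γ σ} → Tm Γ σ → Tm Γ σ → Set
  _→c_ = D._→c_ K

  _→cᵃ_ : ∀ {Γ Δ} → Args Γ Δ → Args Γ Δ → Set
  _→cᵃ_ = D._→cᵃ_ K

  infixr 5 _++ᵃ_
  infix 4 _→c_ _→cᵃ_ _→*_

  -- Renaming and substitution

  infix 4 _≗ʳ_ _≗ˢ_

  _≗ʳ_ : ∀ {Γ Δ} → Ren Γ Δ → Ren Γ Δ → Set
  ρ ≗ʳ ρ' = ∀ {σ} x → ρ {σ} x ≡ ρ' x

  _≗ˢ_ : ∀ {Γ Δ} → Sub Γ Δ → Sub Γ Δ → Set
  s ≗ˢ s' = ∀ {σ} x → s {σ} x ≡ s' x

  liftR-cong : ∀ {Γ Δ τ} {ρ ρ' : Ren Γ Δ} → ρ ≗ʳ ρ' → liftR {τ = τ} ρ ≗ʳ liftR ρ'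
  liftR-cong e here      = refl
  liftR-cong e (there x) = cong there (e x)

  liftR-∘ : ∀ {Γ Δ Θ τ} (ρ' : Ren Δ Θ) (ρ : Ren Γ Δ) → liftR {τ = τ} ρ' ∘ liftR ρ ≗ʳ liftR (ρ' ∘ ρ)
  liftR-∘ ρ' ρ here      = refl
  liftR-∘ ρ' ρ (there x) = refl

  liftR-id : ∀ {Γ τ} → liftR {Γ} {τ = τ} (λ x → x) ≗ʳ (λ x → x)
  liftR-id here      = refl
  liftR-id (there x) = refl

  liftS-cong : ∀ {Γ Δ τ} {s s' : Sub Γ Δ} → s ≗ˢ s' → liftS {τ = τ} s ≗ˢ liftS s'
  liftS-cong e here      = refl
  liftS-cong e (there x) = cong wk (e x)

  liftS-liftR : ∀ {Γ Δ Θ τ} (s : Sub Δ Θ) (ρ : Ren Γ Δ) → liftS {τ = τ} s ∘ liftR ρ ≗ˢ liftS (s ∘ ρ)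
  liftS-liftR s ρ here      = refl
  liftS-liftR s ρ (there x) = refl

  liftS-var : ∀ {Γ τ} → liftS {Γ} {τ = τ} var ≗ˢ var
  liftS-var here      = refl
  liftS-var (there x) = refl

  liftS-ren : ∀ {Γ Δ τ} (ρ : Ren Γ Δ) → var ∘ liftR {τ = τ} ρ ≗ˢ liftS (var ∘ ρ)
  liftS-ren ρ here      = refl
  liftS-ren ρ (there x) = refl

  ren-cong : ∀ {Γ Δ} {ρ ρ' : Ren Γ Δ} → ρ ≗ʳ ρ' → ∀ {σ} (M : Tm Γ σ) → ren ρ M ≡ ren ρ' M
  renArgs-cong : ∀ {Γ Δ} {ρ ρ' : Ren Γ Δ} → ρ ≗ʳ ρ' → ∀ {Θ} (Ns : Args Γ Θ) → renArgs ρ Ns ≡ renArgs ρ' Ns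
  ren-cong e (con c)      = refl
  ren-cong e (var x)      = cong var (e x)
  ren-cong e (lam M)      = cong lam (ren-cong (liftR-cong e) M)
  ren-cong e (app M N)    = cong₂ app (ren-cong e M) (ren-cong e N)
  ren-cong e (box Ns M v) = cong (λ Ns → box Ns M v) (renArgs-cong e Ns)
  ren-cong e (lett N M)   = cong₂ lett (ren-cong e N) (ren-cong (liftR-cong e) M)
  renArgs-cong e []       = refl
  renArgs-cong e (N ∷ Ns) = cong₂ _∷_ (ren-cong e N) (renArgs-cong e Ns)

  ren-∘ : ∀ {Γ Δ Θ} (ρ' : Ren Δ Θ) (ρ : Ren Γ Δ) → ∀ {σ} (M : Tm Γ σ) → ren ρ' (ren ρ M) ≡ ren (ρ' ∘ ρ) M
  renArgs-∘ : ∀ {Γ Δ Θ} (ρ' : Ren Δ Θ) (ρ : Ren Γ Δ) → ∀ {Ξ} (Ns : Args Γ Ξ) →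
              renArgs ρ' (renArgs ρ Ns) ≡ renArgs (ρ' ∘ ρ) Ns
  ren-∘ ρ' ρ (con c)      = refl
  ren-∘ ρ' ρ (var x)      = refl
  ren-∘ ρ' ρ (lam M)      = cong lam (trans (ren-∘ (liftR ρ') (liftR ρ) M) (ren-cong (liftR-∘ ρ' ρ) M))
  ren-∘ ρ' ρ (app M N)    = cong₂ app (ren-∘ ρ' ρ M) (ren-∘ ρ' ρ N)
  ren-∘ ρ' ρ (box Ns M v) = cong (λ Ns → box Ns M v) (renArgs-∘ ρ' ρ Ns)
  ren-∘ ρ' ρ (lett N M)   =
    cong₂ lett (ren-∘ ρ' ρ N) (trans (ren-∘ (liftR ρ') (liftR ρ) M) (ren-cong (liftR-∘ ρ' ρ) M))
  renArgs-∘ ρ' ρ []       = refl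
  renArgs-∘ ρ' ρ (N ∷ Ns) = cong₂ _∷_ (ren-∘ ρ' ρ N) (renArgs-∘ ρ' ρ Ns)

  ren-id : ∀ {Γ σ} (M : Tm Γ σ) → ren (λ x → x) M ≡ M
  renArgs-id : ∀ {Γ Ξ} (Ns : Args Γ Ξ) → renArgs (λ x → x) Ns ≡ Ns
  ren-id (con c)      = refl
  ren-id (var x)      = refl
  ren-id (lam M)      = cong lam (trans (ren-cong liftR-id M) (ren-id M))
  ren-id (app M N)    = cong₂ app (ren-id M) (ren-id N)
  ren-id (box Ns M v) = cong (λ Ns → box Ns M v) (renArgs-id Ns)
  ren-id (lett N M)   = cong₂ lett (ren-id N) (trans (ren-cong liftR-id M) (ren-id M))
  renArgs-id []       = refl
  renArgs-id (N ∷ Ns) = cong₂ _∷_ (ren-id N) (renArgs-id Ns)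

  sub-cong : ∀ {Γ Δ} {s s' : Sub Γ Δ} → s ≗ˢ s' → ∀ {σ} (M : Tm Γ σ) → sub s M ≡ sub s' M
  subArgs-cong : ∀ {Γ Δ} {s s' : Sub Γ Δ} → s ≗ˢ s' → ∀ {Θ} (Ns : Args Γ Θ) → subArgs s Ns ≡ subArgs s' Ns
  sub-cong e (con c)      = refl
  sub-cong e (var x)      = e x
  sub-cong e (lam M)      = cong lam (sub-cong (liftS-cong e) M)
  sub-cong e (app M N)    = cong₂ app (sub-cong e M) (sub-cong e N)
  sub-cong e (box Ns M v) = cong (λ Ns → box Ns M v) (subArgs-cong e Ns)
  sub-cong e (lett N M)   = cong₂ lett (sub-cong e N) (sub-cong (liftS-cong e) M)
  subArgs-cong e []       = refl
  subArgs-cong e (N ∷ Ns) = cong₂ _∷_ (sub-cong e N) (subArgs-cong e Ns)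

  sub-ren : ∀ {Γ Δ Θ} (s : Sub Δ Θ) (ρ : Ren Γ Δ) → ∀ {σ} (M : Tm Γ σ) → sub s (ren ρ M) ≡ sub (s ∘ ρ) M
  subArgs-ren : ∀ {Γ Δ Θ} (s : Sub Δ Θ) (ρ : Ren Γ Δ) → ∀ {Ξ} (Ns : Args Γ Ξ) →
                subArgs s (renArgs ρ Ns) ≡ subArgs (s ∘ ρ) Ns
  sub-ren s ρ (con c)      = refl
  sub-ren s ρ (var x)      = refl
  sub-ren s ρ (lam M)      = cong lam (trans (sub-ren (liftS s) (liftR ρ) M) (sub-cong (liftS-liftR s ρ) M))
  sub-ren s ρ (app M N)    = cong₂ app (sub-ren s ρ M) (sub-ren s ρ N)
  sub-ren s ρ (box Ns M v) = cong (λ Ns → box Ns M v) (subArgs-ren s ρ Ns)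
  sub-ren s ρ (lett N M)   =
    cong₂ lett (sub-ren s ρ N) (trans (sub-ren (liftS s) (liftR ρ) M) (sub-cong (liftS-liftR s ρ) M))
  subArgs-ren s ρ []       = refl
  subArgs-ren s ρ (N ∷ Ns) = cong₂ _∷_ (sub-ren s ρ N) (subArgs-ren s ρ Ns)

  ren-liftS : ∀ {Γ Δ Θ τ} (ρ : Ren Δ Θ) (s : Sub Γ Δ) → ren (liftR {τ = τ} ρ) ∘ liftS s ≗ˢ liftS (ren ρ ∘ s)
  ren-liftS ρ s here      = refl
  ren-liftS ρ s (there x) = trans (ren-∘ (liftR ρ) there (s x)) (sym (ren-∘ there ρ (s x)))

  ren-sub : ∀ {Γ Δ Θ} (ρ : Ren Δ Θ) (s : Sub Γ Δ) → ∀ {σ} (M : Tm Γ σ) → ren ρ (sub s M) ≡ sub (ren ρ ∘ s) M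
  renArgs-sub : ∀ {Γ Δ Θ} (ρ : Ren Δ Θ) (s : Sub Γ Δ) → ∀ {Ξ} (Ns : Args Γ Ξ) →
                renArgs ρ (subArgs s Ns) ≡ subArgs (ren ρ ∘ s) Ns
  ren-sub ρ s (con c)      = refl
  ren-sub ρ s (var x)      = refl
  ren-sub ρ s (lam M)      = cong lam (trans (ren-sub (liftR ρ) (liftS s) M) (sub-cong (ren-liftS ρ s) M))
  ren-sub ρ s (app M N)    = cong₂ app (ren-sub ρ s M) (ren-sub ρ s N)
  ren-sub ρ s (box Ns M v) = cong (λ Ns → box Ns M v) (renArgs-sub ρ s Ns)
  ren-sub ρ s (lett N M)   =
    cong₂ lett (ren-sub ρ s N) (trans (ren-sub (liftR ρ) (liftS s) M) (sub-cong (ren-liftS ρ s) M))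
  renArgs-sub ρ s []       = refl
  renArgs-sub ρ s (N ∷ Ns) = cong₂ _∷_ (ren-sub ρ s N) (renArgs-sub ρ s Ns)

  sub-liftS : ∀ {Γ Δ Θ τ} (s' : Sub Δ Θ) (s : Sub Γ Δ) → sub (liftS {τ = τ} s') ∘ liftS s ≗ˢ liftS (sub s' ∘ s)
  sub-liftS s' s here      = refl
  sub-liftS s' s (there x) = trans (sub-ren (liftS s') there (s x)) (sym (ren-sub there s' (s x)))

  sub-∘ : ∀ {Γ Δ Θ} (s' : Sub Δ Θ) (s : Sub Γ Δ) → ∀ {σ} (M : Tm Γ σ) → sub s' (sub s M) ≡ sub (sub s' ∘ s) M
  subArgs-∘ : ∀ {Γ Δ Θ} (s' : Sub Δ Θ) (s : Sub Γ Δ) → ∀ {Ξ} (Ns : Args Γ Ξ) →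
              subArgs s' (subArgs s Ns) ≡ subArgs (sub s' ∘ s) Ns
  sub-∘ s' s (con c)      = refl
  sub-∘ s' s (var x)      = refl
  sub-∘ s' s (lam M)      = cong lam (trans (sub-∘ (liftS s') (liftS s) M) (sub-cong (sub-liftS s' s) M))
  sub-∘ s' s (app M N)    = cong₂ app (sub-∘ s' s M) (sub-∘ s' s N)
  sub-∘ s' s (box Ns M v) = cong (λ Ns → box Ns M v) (subArgs-∘ s' s Ns)
  sub-∘ s' s (lett N M)   =
    cong₂ lett (sub-∘ s' s N) (trans (sub-∘ (liftS s') (liftS s) M) (sub-cong (sub-liftS s' s) M))
  subArgs-∘ s' s []       = refl
  subArgs-∘ s' s (N ∷ Ns) = cong₂ _∷_ (sub-∘ s' s N) (subArgs-∘ s' s Ns)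

  sub-id : ∀ {Γ σ} (M : Tm Γ σ) → sub var M ≡ M
  subArgs-id : ∀ {Γ Ξ} (Ns : Args Γ Ξ) → subArgs var Ns ≡ Ns
  sub-id (con c)      = refl
  sub-id (var x)      = refl
  sub-id (lam M)      = cong lam (trans (sub-cong liftS-var M) (sub-id M))
  sub-id (app M N)    = cong₂ app (sub-id M) (sub-id N)
  sub-id (box Ns M v) = cong (λ Ns → box Ns M v) (subArgs-id Ns)
  sub-id (lett N M)   = cong₂ lett (sub-id N) (trans (sub-cong liftS-var M) (sub-id M))
  subArgs-id []       = refl
  subArgs-id (N ∷ Ns) = cong₂ _∷_ (sub-id N) (subArgs-id Ns)

  ren≡sub : ∀ {Γ Δ} (ρ : Ren Γ Δ) → ∀ {σ} (M : Tm Γ σ) → ren ρ M ≡ sub (var ∘ ρ) M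
  renArgs≡subArgs : ∀ {Γ Δ} (ρ : Ren Γ Δ) → ∀ {Ξ} (Ns : Args Γ Ξ) → renArgs ρ Ns ≡ subArgs (var ∘ ρ) Ns
  ren≡sub ρ (con c)      = refl
  ren≡sub ρ (var x)      = refl
  ren≡sub ρ (lam M)      = cong lam (trans (ren≡sub (liftR ρ) M) (sub-cong (liftS-ren ρ) M))
  ren≡sub ρ (app M N)    = cong₂ app (ren≡sub ρ M) (ren≡sub ρ N)
  ren≡sub ρ (box Ns M v) = cong (λ Ns → box Ns M v) (renArgs≡subArgs ρ Ns)
  ren≡sub ρ (lett N M)   = cong₂ lett (ren≡sub ρ N) (trans (ren≡sub (liftR ρ) M) (sub-cong (liftS-ren ρ) M))
  renArgs≡subArgs ρ []       = refl
  renArgs≡subArgs ρ (N ∷ Ns) = cong₂ _∷_ (ren≡sub ρ N) (renArgs≡subArgs ρ Ns)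

  wk-[] : ∀ {Γ σ τ} (M : Tm Γ τ) (W : Tm Γ σ) → wk M [ W ] ≡ M
  wk-[] M W = trans (sub-ren (single W) there M) (sub-id M)

  wkArgs-[] : ∀ {Γ σ Ξ} (Ns : Args Γ Ξ) (W : Tm Γ σ) → subArgs (single W) (wkArgs Ns) ≡ Ns
  wkArgs-[] Ns W = trans (subArgs-ren (single W) there Ns) (subArgs-id Ns)

  liftR-wk-[] : ∀ {Γ Δ σ τ} (ρ : Ren Γ Δ) (M : Tm Γ τ) (W : Tm Δ σ) → ren (liftR ρ) (wk M) [ W ] ≡ ren ρ M
  liftR-wk-[] ρ M W = trans (cong (_[ W ]) (trans (ren-∘ _ _ M) (sym (ren-∘ _ _ M)))) (wk-[] (ren ρ M) W)

  sub-[] : ∀ {Γ Δ σ τ} (s : Sub Γ Δ) (M : Tm (σ ∷ Γ) τ) (W : Tm Γ σ) →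
           sub s (M [ W ]) ≡ sub (liftS s) M [ sub s W ]
  sub-[] s M W = trans (sub-∘ s (single W) M)
    (trans (sub-cong (λ { here → refl ; (there x) → sym (wk-[] (s x) (sub s W)) }) M)
           (sym (sub-∘ (single (sub s W)) (liftS s) M)))

  liftR-[] : ∀ {Γ Δ Θ σ τ} (ρ' : Ren Δ Θ) (ρ : Ren Γ Δ) (M : Tm (σ ∷ Γ) τ) (W : Tm Θ σ) →
             ren (liftR ρ') (ren (liftR ρ) M) [ W ] ≡ ren (liftR (ρ' ∘ ρ)) M [ W ]
  liftR-[] ρ' ρ M W = cong (_[ W ]) (trans (ren-∘ _ _ M) (ren-cong (liftR-∘ ρ' ρ) M))

  sub-wk : ∀ {Γ Δ σ τ} (s : Sub Γ Δ) (M : Tm Γ τ) → sub (liftS {τ = σ} s) (wk M) ≡ wk (sub s M)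
  sub-wk s M = trans (sub-ren (liftS s) there M) (sym (ren-sub there s M))

  subArgs-wk : ∀ {Γ Δ σ Ξ} (s : Sub Γ Δ) (Ns : Args Γ Ξ) →
               subArgs (liftS {τ = σ} s) (wkArgs Ns) ≡ wkArgs (subArgs s Ns)
  subArgs-wk s Ns = trans (subArgs-ren (liftS s) there Ns) (sym (renArgs-sub there s Ns))

  subArgs-++ : ∀ {Γ Δ Ξ₁ Ξ₂} (s : Sub Γ Δ) (Xs : Args Γ Ξ₁) (Ys : Args Γ Ξ₂) →
               subArgs s (Xs ++ᵃ Ys) ≡ subArgs s Xs ++ᵃ subArgs s Ys
  subArgs-++ s []       Ys = refl
  subArgs-++ s (X ∷ Xs) Ys = cong (sub s X ∷_) (subArgs-++ s Xs Ys)

  renArgs-++ : ∀ {Γ Δ Ξ₁ Ξ₂} (ρ : Ren Γ Δ) (Xs : Args Γ Ξ₁) (Ys : Args Γ Ξ₂) →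
               renArgs ρ (Xs ++ᵃ Ys) ≡ renArgs ρ Xs ++ᵃ renArgs ρ Ys
  renArgs-++ ρ []       Ys = refl
  renArgs-++ ρ (X ∷ Xs) Ys = cong (ren ρ X ∷_) (renArgs-++ ρ Xs Ys)

  ValueSub : ∀ {Γ Δ} → Sub Γ Δ → Set
  ValueSub {Γ} s = ∀ {σ} (x : Γ ∋ σ) → Value (s x)

  ren-value : ∀ {Γ Δ σ} (ρ : Ren Γ Δ) {M : Tm Γ σ} → Value M → Value (ren ρ M)
  ren-values : ∀ {Γ Δ Ξ} (ρ : Ren Γ Δ) {Ns : Args Γ Ξ} → Values Ns → Values (renArgs ρ Ns)
  ren-value ρ vcon      = vcon
  ren-value ρ vvar      = vvar
  ren-value ρ vlam      = vlam
  ren-value ρ (vbox vs) = vbox (ren-values ρ vs)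
  ren-values ρ []       = []
  ren-values ρ (v ∷ vs) = ren-value ρ v ∷ ren-values ρ vs

  liftS-value : ∀ {Γ Δ τ} {s : Sub Γ Δ} → ValueSub s → ValueSub (liftS {τ = τ} s)
  liftS-value vs here      = vvar
  liftS-value vs (there x) = ren-value there (vs x)

  single-value : ∀ {Γ σ} {V : Tm Γ σ} → Value V → ValueSub (single V)
  single-value v here      = v
  single-value v (there x) = vvar

  sub-value : ∀ {Γ Δ σ} {s : Sub Γ Δ} → ValueSub s → {M : Tm Γ σ} → Value M → Value (sub s M)
  sub-values : ∀ {Γ Δ Ξ} {s : Sub Γ Δ} → ValueSub s → {Ns : Args Γ Ξ} → Values Ns → Values (subArgs s Ns)
  sub-value vs vcon            = vcon
  sub-value vs {var x} vvar    = vs x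
  sub-value vs vlam            = vlam
  sub-value vs (vbox ws)       = vbox (sub-values vs ws)
  sub-values vs []       = []
  sub-values vs (v ∷ ws) = sub-value vs v ∷ sub-values vs ws

  sub-value⁻ : ∀ {Γ Δ σ} (s : Sub Γ Δ) (M : Tm Γ σ) → Value (sub s M) → Value M
  sub-values⁻ : ∀ {Γ Δ Ξ} (s : Sub Γ Δ) (Ns : Args Γ Ξ) → Values (subArgs s Ns) → Values Ns
  sub-value⁻ s (con c)      _         = vcon
  sub-value⁻ s (var x)      _         = vvar
  sub-value⁻ s (lam M)      _         = vlam
  sub-value⁻ s (box Ns M _) (vbox ws) = vbox (sub-values⁻ s Ns ws)
  sub-values⁻ s []       []       = []
  sub-values⁻ s (N ∷ Ns) (w ∷ ws) = sub-value⁻ s N w ∷ sub-values⁻ s Ns ws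

  value? : ∀ {Γ σ} (M : Tm Γ σ) → Dec (Value M)
  values? : ∀ {Γ Ξ} (Ns : Args Γ Ξ) → Dec (Values Ns)
  value? (con c)      = yes vcon
  value? (var x)      = yes vvar
  value? (lam M)      = yes vlam
  value? (app M N)    = no λ ()
  value? (box Ns M v) with values? Ns
  ... | yes ws = yes (vbox ws)
  ... | no ¬ws = no λ { (vbox ws) → ¬ws ws }
  value? (lett N M)   = no λ ()
  values? []       = yes []
  values? (N ∷ Ns) with value? N | values? Ns
  ... | yes w | yes ws = yes (w ∷ ws)
  ... | no ¬w | _      = no λ { (w ∷ _) → ¬w w }
  ... | yes _ | no ¬ws = no λ { (_ ∷ ws) → ¬ws ws }

  value-irrelevant : ∀ {Γ σ} {M : Tm Γ σ} (v v' : Value M) → v ≡ v'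
  values-irrelevant : ∀ {Γ Ξ} {Ns : Args Γ Ξ} (v v' : Values Ns) → v ≡ v'
  value-irrelevant vcon      vcon       = refl
  value-irrelevant vvar      vvar       = refl
  value-irrelevant vlam      vlam       = refl
  value-irrelevant (vbox ws) (vbox ws') = cong vbox (values-irrelevant ws ws')
  values-irrelevant []       []         = refl
  values-irrelevant (v ∷ vs) (v' ∷ vs') = cong₂ _∷_ (value-irrelevant v v') (values-irrelevant vs vs')

  values-++ : ∀ {Γ Ξ₁ Ξ₂} {Xs : Args Γ Ξ₁} {Ys : Args Γ Ξ₂} → Values Xs → Values Ys → Values (Xs ++ᵃ Ys)
  values-++ []       ws = ws
  values-++ (v ∷ vs) ws = v ∷ values-++ vs ws

  values-++⁻ : ∀ {Γ Ξ₁ Ξ₂} (Xs : Args Γ Ξ₁) {Ys : Args Γ Ξ₂} → Values (Xs ++ᵃ Ys) → Values Xs × Values Ys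
  values-++⁻ []       vs       = [] , vs
  values-++⁻ (X ∷ Xs) (v ∷ vs) = let (a , b) = values-++⁻ Xs vs in (v ∷ a) , b

  sub-→c : ∀ {Γ Δ σ} {s : Sub Γ Δ} → ValueSub s → {M N : Tm Γ σ} → M →c N → sub s M →c sub s N
  subArgs-→c : ∀ {Γ Δ Ξ} {s : Sub Γ Δ} → ValueSub s → {Ms Ns : Args Γ Ξ} → Ms →cᵃ Ns →
               subArgs s Ms →cᵃ subArgs s Ns
  sub-→c vs let-var = let-var
  sub-→c {s = s} vs (let-val {V = V} {M = M} v) =
    subst₂ _→c_ refl (sym (sub-[] s M V)) (let-val (sub-value vs v))
  sub-→c {s = s} vs (beta {M = M} {V = V} v) =
    subst₂ _→c_ refl (sym (sub-[] s M V)) (beta (sub-value vs v))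
  sub-→c {s = s} vs (eta {V = V} v) =
    subst₂ _→c_ (cong (λ t → lam (app t (var here))) (sym (sub-wk s V))) refl (eta (sub-value vs v))
  sub-→c {s = s} vs (let-assoc {M = M}) =
    subst₂ _→c_ refl (cong (λ t → lett _ (lett _ t)) assoc-body) let-assoc
    where
    assoc-body : ren (liftR there) (sub (liftS s) M) ≡ sub (liftS (liftS s)) (ren (liftR there) M)
    assoc-body = trans (ren-sub (liftR there) (liftS s) M)
      (trans (sub-cong (λ { here → refl ; (there x) → trans (ren-∘ (liftR there) there (s x))
                                                            (sym (ren-∘ there there (s x))) }) M)
             (sym (sub-ren (liftS (liftS s)) (liftR there) M)))
  sub-→c {s = s} vs (lift-appˡ {M = M} ¬a) =
    subst₂ _→c_ refl (cong (λ t → lett _ (app (var here) t)) (sym (sub-wk s M)))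
          (lift-appˡ (¬a ∘ sub-value⁻ s _))
  sub-→c {s = s} vs (lift-appʳ {V = V} v ¬a) =
    subst₂ _→c_ refl (cong (λ t → lett _ (app t (var here))) (sym (sub-wk s V)))
          (lift-appʳ (sub-value vs v) (¬a ∘ sub-value⁻ s _))
  sub-→c {s = s} vs (lift-box {Vs = Vs} {A = A} {Ms = Ms} {M = M} {v = v} ws ¬a) =
    subst₂ _→c_ (cong (λ Xs → box Xs M v) (sym (subArgs-++ s Vs (A ∷ Ms))))
                (cong (λ Xs → lett (sub s A) (box Xs M v))
                      (sym (trans (subArgs-++ (liftS s) (wkArgs Vs) (var here ∷ wkArgs Ms))
                                  (cong₂ _++ᵃ_ (subArgs-wk s Vs) (cong (var here ∷_) (subArgs-wk s Ms))))))
                (lift-box (sub-values vs ws) (¬a ∘ sub-value⁻ s A))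
  sub-→c vs box-var = box-var
  sub-→c {s = s} vs (box-merge {Ws = Ws} {Ns = Ns} {V = V} {vV = vV} {Ps = Ps} {M = M} {vM = vM} {vM' = vM'} ws) =
    subst₂ _→c_ (cong (λ Xs → box Xs M vM) (sym (subArgs-++ s Ws (box Ns V vV ∷ Ps))))
                (cong (λ Xs → box Xs _ vM')
                      (sym (trans (subArgs-++ s Ws (Ns ++ᵃ Ps)) (cong (subArgs s Ws ++ᵃ_) (subArgs-++ s Ns Ps)))))
                (box-merge {vM' = vM'} (sub-values vs ws))
  sub-→c vs (ξ-lam r)      = ξ-lam (sub-→c (liftS-value vs) r)
  sub-→c vs (ξ-appˡ r)     = ξ-appˡ (sub-→c vs r)
  sub-→c vs (ξ-appʳ r)     = ξ-appʳ (sub-→c vs r)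
  sub-→c vs (ξ-letˡ r)     = ξ-letˡ (sub-→c vs r)
  sub-→c vs (ξ-letʳ r)     = ξ-letʳ (sub-→c (liftS-value vs) r)
  sub-→c vs (ξ-box-arg r)  = ξ-box-arg (subArgs-→c vs r)
  sub-→c vs (ξ-box-body r) = ξ-box-body r
  subArgs-→c vs (hd r) = hd (sub-→c vs r)
  subArgs-→c vs (tl r) = tl (subArgs-→c vs r)

  ren-→c : ∀ {Γ Δ σ} (ρ : Ren Γ Δ) {M N : Tm Γ σ} → M →c N → ren ρ M →c ren ρ N
  ren-→c ρ {M} {N} r = subst₂ _→c_ (sym (ren≡sub ρ M)) (sym (ren≡sub ρ N)) (sub-→c (λ x → vvar) r)

  renArgs-→c : ∀ {Γ Δ Ξ} (ρ : Ren Γ Δ) {Ms Ns : Args Γ Ξ} → Ms →cᵃ Ns → renArgs ρ Ms →cᵃ renArgs ρ Ns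
  renArgs-→c ρ (hd r)  = hd (ren-→c ρ r)
  renArgs-→c ρ (tl rs) = tl (renArgs-→c ρ rs)

  value-→c : ∀ {Γ σ} {M N : Tm Γ σ} → Value M → M →c N → Value N
  values-→c : ∀ {Γ Ξ} {Ms Ns : Args Γ Ξ} → Values Ms → Ms →cᵃ Ns → Values Ns
  value-→c vlam (eta v)   = v
  value-→c vlam (ξ-lam r) = vlam
  value-→c (vbox ws) (lift-box {Vs = Vs} _ ¬a) with values-++⁻ Vs ws
  ... | _ , (a ∷ _) = ⊥-elim (¬a a)
  value-→c (vbox (w ∷ [])) box-var = w
  value-→c (vbox ws) (box-merge {Ws = Ws} _) with values-++⁻ Ws ws
  ... | a , (vbox ns ∷ ps) = vbox (values-++ a (values-++ ns ps))
  value-→c (vbox ws) (ξ-box-arg r)  = vbox (values-→c ws r)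
  value-→c (vbox ws) (ξ-box-body r) = vbox ws
  values-→c (w ∷ ws) (hd r) = value-→c w r ∷ ws
  values-→c (w ∷ ws) (tl r) = w ∷ values-→c ws r

  SN : ∀ {Γ σ} → Tm Γ σ → Set
  SN = Acc (flip _→c_)

  SN-→c : ∀ {Γ σ} {M N : Tm Γ σ} → SN M → M →c N → SN N
  SN-→c (acc h) r = h r

  _→*_ : ∀ {Γ σ} → Tm Γ σ → Tm Γ σ → Set
  _→*_ = Star _→c_

  SN-→* : ∀ {Γ σ} {M N : Tm Γ σ} → SN M → M →* N → SN N
  SN-→* s ε*      = s
  SN-→* s (r ◅ p) = SN-→* (SN-→c s r) p

  SN-map⁻ : ∀ {Γ Δ σ τ} (f : Tm Γ σ → Tm Δ τ) → (∀ {M N} → M →c N → f M →c f N) →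
            ∀ {M} → SN (f M) → SN M
  SN-map⁻ f f-→c (acc h) = acc (λ r → SN-map⁻ f f-→c (h (f-→c r)))

  SN-ren⁻ : ∀ {Γ Δ σ} (ρ : Ren Γ Δ) {M : Tm Γ σ} → SN (ren ρ M) → SN M
  SN-ren⁻ ρ = SN-map⁻ (ren ρ) (ren-→c ρ)

  app-→* : ∀ {Γ σ τ} {M M' : Tm Γ (σ ⊃ τ)} {N N' : Tm Γ σ} → M →* M' → N →* N' → app M N →* app M' N'
  app-→* p q = gmap _ ξ-appˡ p ◅◅ gmap _ ξ-appʳ q

  lett-→* : ∀ {Γ σ τ} {M M' : Tm Γ σ} {N N' : Tm (σ ∷ Γ) τ} → M →* M' → N →* N' → lett M N →* lett M' N'
  lett-→* p q = gmap _ ξ-letˡ p ◅◅ gmap _ ξ-letʳ q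

  data _→*ᵃ_ {Γ} : ∀ {Ξ} → Args Γ Ξ → Args Γ Ξ → Set where
    []  : [] →*ᵃ []
    _∷_ : ∀ {σ Ξ} {M N : Tm Γ (□ σ)} {Ms Ns : Args Γ Ξ} → M →* N → Ms →*ᵃ Ns → (M ∷ Ms) →*ᵃ (N ∷ Ns)

  box-→* : ∀ {Γ Ξ τ} {Ms Ns : Args Γ Ξ} {B : Tm Ξ τ} {v : Value B} → Ms →*ᵃ Ns → box Ms B v →* box Ns B v
  box-→* {B = B} {v} = go (λ Xs → box Xs B v) ξ-box-arg
    where
    go : ∀ {Γ Ξ Δ τ} (f : Args Γ Ξ → Tm Δ τ) → (∀ {Ms Ns} → Ms →cᵃ Ns → f Ms →c f Ns) →
         ∀ {Ms Ns} → Ms →*ᵃ Ns → f Ms →* f Ns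
    go f f-→c []                          = ε*
    go f f-→c (_∷_ {N = N} {Ms = Ms} p ps) =
      gmap (λ t → f (t ∷ Ms)) (f-→c ∘ hd) p ◅◅ go (λ Xs → f (N ∷ Xs)) (f-→c ∘ tl) ps

  _→*ˢ_ : ∀ {Γ Δ} → Sub Γ Δ → Sub Γ Δ → Set
  _→*ˢ_ {Γ} s s' = ∀ {σ} (x : Γ ∋ σ) → s x →* s' x

  sub-→* : ∀ {Γ Δ} {s s' : Sub Γ Δ} → s →*ˢ s' → ∀ {σ} (M : Tm Γ σ) → sub s M →* sub s' M
  subArgs-→* : ∀ {Γ Δ} {s s' : Sub Γ Δ} → s →*ˢ s' → ∀ {Ξ} (Ns : Args Γ Ξ) → subArgs s Ns →*ᵃ subArgs s' Ns
  liftS-→* : ∀ {Γ Δ τ} {s s' : Sub Γ Δ} → s →*ˢ s' → liftS {τ = τ} s →*ˢ liftS s'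
  liftS-→* p here      = ε*
  liftS-→* p (there x) = gmap wk (ren-→c there) (p x)
  sub-→* p (con c)      = ε*
  sub-→* p (var x)      = p x
  sub-→* p (lam M)      = gmap lam ξ-lam (sub-→* (liftS-→* p) M)
  sub-→* p (app M N)    = app-→* (sub-→* p M) (sub-→* p N)
  sub-→* p (box Ns M v) = box-→* (subArgs-→* p Ns)
  sub-→* p (lett N M)   = lett-→* (sub-→* p N) (sub-→* (liftS-→* p) M)
  subArgs-→* p []       = []
  subArgs-→* p (N ∷ Ns) = sub-→* p N ∷ subArgs-→* p Ns

  []-→* : ∀ {Γ σ τ} (M : Tm (σ ∷ Γ) τ) {V V' : Tm Γ σ} → V →c V' → M [ V ] →* M [ V' ]
  []-→* M r = sub-→* (λ { here → r ◅ ε* ; (there x) → ε* }) M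

  -- Evaluation stacks

  data ArgsHole (Γ : Ctx) : Ctx → Ty → Set where
    hole : ∀ {ρ Δ} → Args Γ Δ → ArgsHole Γ (ρ ∷ Δ) ρ
    cons : ∀ {σ ρ Δ} (W : Tm Γ (□ σ)) → Value W → ArgsHole Γ Δ ρ → ArgsHole Γ (σ ∷ Δ) ρ

  fill : ∀ {Γ Δ ρ} → ArgsHole Γ Δ ρ → Tm Γ (□ ρ) → Args Γ Δ
  fill (hole Ms)     X = X ∷ Ms
  fill (cons W _ H) X = W ∷ fill H X

  cons-≡ : ∀ {Γ Δ ρ σ} {W W' : Tm Γ (□ σ)} {w : Value W} {w' : Value W'} {H H' : ArgsHole Γ Δ ρ} →
           W ≡ W' → H ≡ H' → cons W w H ≡ cons W' w' H'
  cons-≡ {w = w} {w'} refl refl = cong (λ w → cons _ w _) (value-irrelevant w w')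

  renHole : ∀ {Γ Γ' Δ ρ} → Ren Γ Γ' → ArgsHole Γ Δ ρ → ArgsHole Γ' Δ ρ
  renHole ρ (hole Ms)     = hole (renArgs ρ Ms)
  renHole ρ (cons W w H) = cons (ren ρ W) (ren-value ρ w) (renHole ρ H)

  renHole-∘ : ∀ {Γ Γ' Γ'' Δ ρ'} (ρ₂ : Ren Γ' Γ'') (ρ₁ : Ren Γ Γ') (H : ArgsHole Γ Δ ρ') →
              renHole ρ₂ (renHole ρ₁ H) ≡ renHole (ρ₂ ∘ ρ₁) H
  renHole-∘ ρ₂ ρ₁ (hole Ms)     = cong hole (renArgs-∘ ρ₂ ρ₁ Ms)
  renHole-∘ ρ₂ ρ₁ (cons W w H) = cons-≡ (ren-∘ ρ₂ ρ₁ W) (renHole-∘ ρ₂ ρ₁ H)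

  renHole-id : ∀ {Γ Δ ρ'} (H : ArgsHole Γ Δ ρ') → renHole (λ x → x) H ≡ H
  renHole-id (hole Ms)     = cong hole (renArgs-id Ms)
  renHole-id (cons W w H) = cons-≡ (ren-id W) (renHole-id H)

  fill-ren : ∀ {Γ Γ' Δ ρ'} (ρ : Ren Γ Γ') (H : ArgsHole Γ Δ ρ') (X : Tm Γ (□ ρ')) →
             renArgs ρ (fill H X) ≡ fill (renHole ρ H) (ren ρ X)
  fill-ren ρ (hole Ms)     X = refl
  fill-ren ρ (cons W w H) X = cong (ren ρ W ∷_) (fill-ren ρ H X)

  fill-→c : ∀ {Γ Δ ρ} (H : ArgsHole Γ Δ ρ) {X X' : Tm Γ (□ ρ)} → X →c X' → fill H X →cᵃ fill H X'
  fill-→c (hole Ms)     r = hd r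
  fill-→c (cons W w H) r = tl (fill-→c H r)

  fill-values⁻ : ∀ {Γ Δ ρ} (H : ArgsHole Γ Δ ρ) {X : Tm Γ (□ ρ)} → Values (fill H X) → Value X
  fill-values⁻ (hole Ms)     (v ∷ _)  = v
  fill-values⁻ (cons W w H) (_ ∷ vs) = fill-values⁻ H vs

  fill-wk-[] : ∀ {Γ Δ ρ} (H : ArgsHole Γ Δ ρ) (W : Tm Γ (□ ρ)) →
               subArgs (single W) (fill (renHole there H) (var here)) ≡ fill H W
  fill-wk-[] (hole Ms)      W = cong (W ∷_) (wkArgs-[] Ms W)
  fill-wk-[] (cons W' w H) W = cong₂ _∷_ (wk-[] W' W) (fill-wk-[] H W)

  prepend : ∀ {Γ Δ₁ Δ ρ} (Ws : Args Γ Δ₁) → Values Ws → ArgsHole Γ Δ ρ → ArgsHole Γ (Δ₁ ++ Δ) ρ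
  prepend []       []       H = H
  prepend (W ∷ Ws) (w ∷ ws) H = cons W w (prepend Ws ws H)

  append : ∀ {Γ Δ Δ₂ ρ} → ArgsHole Γ Δ ρ → Args Γ Δ₂ → ArgsHole Γ (Δ ++ Δ₂) ρ
  append (hole Ms)     Ps = hole (Ms ++ᵃ Ps)
  append (cons W w H) Ps = cons W w (append H Ps)

  fill-prepend : ∀ {Γ Δ₁ Δ ρ} (Ws : Args Γ Δ₁) (ws : Values Ws) (H : ArgsHole Γ Δ ρ) (X : Tm Γ (□ ρ)) →
                 fill (prepend Ws ws H) X ≡ Ws ++ᵃ fill H X
  fill-prepend []       []       H X = refl
  fill-prepend (W ∷ Ws) (w ∷ ws) H X = cong (W ∷_) (fill-prepend Ws ws H X)

  fill-append : ∀ {Γ Δ Δ₂ ρ} (H : ArgsHole Γ Δ ρ) (Ps : Args Γ Δ₂) (X : Tm Γ (□ ρ)) →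
                fill (append H Ps) X ≡ fill H X ++ᵃ Ps
  fill-append (hole Ms)     Ps X = refl
  fill-append (cons W w H) Ps X = cong (W ∷_) (fill-append H Ps X)

  renHole-prepend : ∀ {Γ Γ' Δ₁ Δ ρ'} (ρ : Ren Γ Γ') (Ws : Args Γ Δ₁) (ws : Values Ws) (H : ArgsHole Γ Δ ρ') →
                    renHole ρ (prepend Ws ws H) ≡ prepend (renArgs ρ Ws) (ren-values ρ ws) (renHole ρ H)
  renHole-prepend ρ []       []       H = refl
  renHole-prepend ρ (W ∷ Ws) (w ∷ ws) H = cong (cons (ren ρ W) (ren-value ρ w)) (renHole-prepend ρ Ws ws H)

  renHole-append : ∀ {Γ Γ' Δ Δ₂ ρ'} (ρ : Ren Γ Γ') (H : ArgsHole Γ Δ ρ') (Ps : Args Γ Δ₂) →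
                   renHole ρ (append H Ps) ≡ append (renHole ρ H) (renArgs ρ Ps)
  renHole-append ρ (hole Ms)     Ps = cong hole (renArgs-++ ρ Ms Ps)
  renHole-append ρ (cons W w H) Ps = cong (cons (ren ρ W) (ren-value ρ w)) (renHole-append ρ H Ps)

  data HoleView {Γ} : ∀ {Δ ρ} → ArgsHole Γ Δ ρ → Set where
    view : ∀ {Δ₁ Δ₂ ρ} (Vs : Args Γ Δ₁) (vs : Values Vs) (Ms : Args Γ Δ₂) →
           HoleView (prepend Vs vs (hole {ρ = ρ} Ms))

  holeView : ∀ {Γ Δ ρ} (H : ArgsHole Γ Δ ρ) → HoleView H
  holeView (hole Ms) = view [] [] Ms
  holeView (cons W w H) with holeView H
  ... | view Vs vs Ms = view (W ∷ Vs) (w ∷ vs) Ms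

  lift-box-hole : ∀ {Γ Δ ρ τ} (H : ArgsHole Γ Δ ρ) {X : Tm Γ (□ ρ)} → ¬ Value X → (B : Tm Δ τ) (v : Value B) →
                  box (fill H X) B v →c lett X (box (fill (renHole there H) (var here)) B v)
  lift-box-hole H {X} ¬x B v with holeView H
  ... | view Vs vs Ms =
    subst₂ _→c_ (cong (λ Xs → box Xs B v) (sym (fill-prepend Vs vs (hole Ms) X)))
                (cong (λ Xs → lett X (box Xs B v))
                      (sym (trans (cong (λ h → fill h (var here)) (renHole-prepend there Vs vs (hole Ms)))
                                  (fill-prepend (wkArgs Vs) (ren-values there vs) (hole (wkArgs Ms)) (var here)))))
                (lift-box vs ¬x)

  data Frame (Γ : Ctx) : Ty → Ty → Set where
    letF : ∀ {σ ρ} → Tm (σ ∷ Γ) ρ → Frame Γ σ ρ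
    boxF : ∀ {Δ ρ τ} → ArgsHole Γ Δ ρ → (B : Tm Δ τ) → Value B → Frame Γ (□ ρ) (□ τ)

  plugF : ∀ {Γ σ ρ} → Frame Γ σ ρ → Tm Γ σ → Tm Γ ρ
  plugF (letF C)     X = lett X C
  plugF (boxF H B v) X = box (fill H X) B v

  renF : ∀ {Γ Δ σ ρ} → Ren Γ Δ → Frame Γ σ ρ → Frame Δ σ ρ
  renF ρ (letF C)     = letF (ren (liftR ρ) C)
  renF ρ (boxF H B v) = boxF (renHole ρ H) B v

  renF-∘ : ∀ {Γ Δ Θ σ τ} (ρ' : Ren Δ Θ) (ρ : Ren Γ Δ) (F : Frame Γ σ τ) → renF ρ' (renF ρ F) ≡ renF (ρ' ∘ ρ) F
  renF-∘ ρ' ρ (letF C)     = cong letF (trans (ren-∘ (liftR ρ') (liftR ρ) C) (ren-cong (liftR-∘ ρ' ρ) C))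
  renF-∘ ρ' ρ (boxF H B v) = cong (λ h → boxF h B v) (renHole-∘ ρ' ρ H)

  renF-id : ∀ {Γ σ τ} (F : Frame Γ σ τ) → renF (λ x → x) F ≡ F
  renF-id (letF C)     = cong letF (trans (ren-cong liftR-id C) (ren-id C))
  renF-id (boxF H B v) = cong (λ h → boxF h B v) (renHole-id H)

  plugF-→c : ∀ {Γ σ τ} (F : Frame Γ σ τ) {M N : Tm Γ σ} → M →c N → plugF F M →c plugF F N
  plugF-→c (letF C)     r = ξ-letˡ r
  plugF-→c (boxF H B v) r = ξ-box-arg (fill-→c H r)

  plugF-nonvalue : ∀ {Γ σ τ} (F : Frame Γ σ τ) {X : Tm Γ σ} → ¬ Value X → ¬ Value (plugF F X)
  plugF-nonvalue (letF C)     ¬x ()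
  plugF-nonvalue (boxF H B v) ¬x (vbox ws) = ¬x (fill-values⁻ H ws)

  infixr 5 _▷_
  data Stack (Γ : Ctx) : Ty → Ty → Set where
    ε   : ∀ {τ} → Stack Γ τ τ
    _▷_ : ∀ {σ ρ τ} → Frame Γ σ ρ → Stack Γ ρ τ → Stack Γ σ τ

  plug : ∀ {Γ σ τ} → Stack Γ σ τ → Tm Γ σ → Tm Γ τ
  plug ε       M = M
  plug (F ▷ S) M = plug S (plugF F M)

  renStack : ∀ {Γ Δ σ τ} → Ren Γ Δ → Stack Γ σ τ → Stack Δ σ τ
  renStack ρ ε       = ε
  renStack ρ (F ▷ S) = renF ρ F ▷ renStack ρ S

  renStack-∘ : ∀ {Γ Δ Θ σ τ} (ρ' : Ren Δ Θ) (ρ : Ren Γ Δ) (S : Stack Γ σ τ) →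
               renStack ρ' (renStack ρ S) ≡ renStack (ρ' ∘ ρ) S
  renStack-∘ ρ' ρ ε       = refl
  renStack-∘ ρ' ρ (F ▷ S) = cong₂ _▷_ (renF-∘ ρ' ρ F) (renStack-∘ ρ' ρ S)

  renStack-id : ∀ {Γ σ τ} (S : Stack Γ σ τ) → renStack (λ x → x) S ≡ S
  renStack-id ε       = refl
  renStack-id (F ▷ S) = cong₂ _▷_ (renF-id F) (renStack-id S)

  plug-→c : ∀ {Γ σ τ} (S : Stack Γ σ τ) {M N : Tm Γ σ} → M →c N → plug S M →c plug S N
  plug-→c ε       r = r
  plug-→c (F ▷ S) r = plug-→c S (plugF-→c F r)

  SN-plug⁻ : ∀ {Γ σ τ} (S : Stack Γ σ τ) {M : Tm Γ σ} → SN (plug S M) → SN M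
  SN-plug⁻ S = SN-map⁻ (plug S) (plug-→c S)

  boxFrames : ∀ {Γ σ τ} → Stack Γ σ τ → ℕ
  boxFrames ε              = 0
  boxFrames (letF _ ▷ S)   = boxFrames S
  boxFrames (boxF _ _ _ ▷ S) = suc (boxFrames S)

  boxFrames-▷ : ∀ {Γ σ ρ τ} (F : Frame Γ σ ρ) (S : Stack Γ ρ τ) → boxFrames S ≤ boxFrames (F ▷ S)
  boxFrames-▷ (letF C)     S = ≤-refl
  boxFrames-▷ (boxF H B v) S = n≤1+n _

  infix 4 _⇒ʰ_ _⇒ˢ_

  data _⇒ʰ_ {Γ} : ∀ {Δ ρ} → ArgsHole Γ Δ ρ → ArgsHole Γ Δ ρ → Set where
    headʰ : ∀ {σ Δ ρ} {W W' : Tm Γ (□ σ)} {w : Value W} {w' : Value W'} {H : ArgsHole Γ Δ ρ} →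
            W →c W' → cons W w H ⇒ʰ cons W' w' H
    tailʰ : ∀ {σ Δ ρ} {W : Tm Γ (□ σ)} {w : Value W} {H H' : ArgsHole Γ Δ ρ} →
            H ⇒ʰ H' → cons W w H ⇒ʰ cons W w H'
    restʰ : ∀ {Δ ρ} {Ms Ms' : Args Γ Δ} → Ms →cᵃ Ms' → hole {ρ = ρ} Ms ⇒ʰ hole Ms'

  fill-⇒ʰ : ∀ {Γ Δ ρ} {H H' : ArgsHole Γ Δ ρ} → H ⇒ʰ H' → (X : Tm Γ (□ ρ)) → fill H X →cᵃ fill H' X
  fill-⇒ʰ (headʰ r)  X = hd r
  fill-⇒ʰ (tailʰ p)  X = tl (fill-⇒ʰ p X)
  fill-⇒ʰ (restʰ rs) X = tl rs

  renHole-⇒ʰ : ∀ {Γ Γ' Δ ρ'} (ρ : Ren Γ Γ') {H H' : ArgsHole Γ Δ ρ'} → H ⇒ʰ H' → renHole ρ H ⇒ʰ renHole ρ H'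
  renHole-⇒ʰ ρ (headʰ r)  = headʰ (ren-→c ρ r)
  renHole-⇒ʰ ρ (tailʰ p)  = tailʰ (renHole-⇒ʰ ρ p)
  renHole-⇒ʰ ρ (restʰ rs) = restʰ (renArgs-→c ρ rs)

  data _⇒ˢ_ {Γ} : ∀ {σ τ} → Stack Γ σ τ → Stack Γ σ τ → Set where
    let-bodyˢ  : ∀ {σ ρ τ} {C C' : Tm (σ ∷ Γ) ρ} {S : Stack Γ ρ τ} → C →c C' → (letF C ▷ S) ⇒ˢ (letF C' ▷ S)
    let-varˢ   : ∀ {σ τ} {S : Stack Γ σ τ} → (letF (var here) ▷ S) ⇒ˢ S
    let-assocˢ : ∀ {σ ρ ρ' τ} {C : Tm (σ ∷ Γ) ρ} {E : Tm (ρ ∷ Γ) ρ'} {S : Stack Γ ρ' τ} →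
                 (letF C ▷ (letF E ▷ S)) ⇒ˢ (letF (lett C (ren (liftR there) E)) ▷ S)
    box-bodyˢ  : ∀ {Δ ρ τ τ'} {H : ArgsHole Γ Δ ρ} {B B' : Tm Δ τ} {v : Value B} {v' : Value B'}
                   {S : Stack Γ (□ τ) τ'} →
                 B →c B' → (boxF H B v ▷ S) ⇒ˢ (boxF H B' v' ▷ S)
    box-argsˢ  : ∀ {Δ ρ τ τ'} {H H' : ArgsHole Γ Δ ρ} {B : Tm Δ τ} {v : Value B} {S : Stack Γ (□ τ) τ'} →
                 H ⇒ʰ H' → (boxF H B v ▷ S) ⇒ˢ (boxF H' B v ▷ S)
    box-mergeˢ : ∀ {Δw Δy Δz σ ρ τ τ'} {Ws : Args Γ Δw} {ws : Values Ws} {Ns : Args Γ Δy} {ns : Values Ns}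
                   {V : Tm Δy σ} {vV : Value V} {H : ArgsHole Γ Δz ρ} {M : Tm (Δw ++ σ ∷ Δz) τ} {vM : Value M}
                   {vM' : Value (sub (mergeSub Δw V) M)} {S : Stack Γ (□ τ) τ'} →
                 (boxF (prepend Ws ws (cons (box Ns V vV) (vbox ns) H)) M vM ▷ S) ⇒ˢ
                 (boxF (prepend Ws ws (prepend Ns ns H)) (sub (mergeSub Δw V) M) vM' ▷ S)
    box-varˢ   : ∀ {σ τ'} {S : Stack Γ (□ σ) τ'} → (boxF (hole []) (var here) vvar ▷ S) ⇒ˢ S
    liftˢ      : ∀ {Δ ρ τ τ'} {H : ArgsHole Γ Δ ρ} {B : Tm Δ τ} {v : Value B} {S : Stack Γ (□ τ) τ'} →
                 (boxF H B v ▷ S) ⇒ˢ (letF (box (fill (renHole there H) (var here)) B v) ▷ S)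
    box-box-mergeˢ : ∀ {Δw Δy Δz σ ρ τ τ'} {H : ArgsHole Γ Δy ρ} {B : Tm Δy σ} {v : Value B}
                       {Ws : Args Γ Δw} {ws : Values Ws} {Ps : Args Γ Δz} {M : Tm (Δw ++ σ ∷ Δz) τ}
                       {vM : Value M} {vM' : Value (sub (mergeSub Δw B) M)} {S : Stack Γ (□ τ) τ'} →
                     (boxF H B v ▷ (boxF (prepend Ws ws (hole Ps)) M vM ▷ S)) ⇒ˢ
                     (boxF (prepend Ws ws (append H Ps)) (sub (mergeSub Δw B) M) vM' ▷ S)
    tailˢ      : ∀ {σ ρ τ} {F : Frame Γ σ ρ} {S S' : Stack Γ ρ τ} → S ⇒ˢ S' → (F ▷ S) ⇒ˢ (F ▷ S')

  -- The one kind of stack step that is a reduction of  plug S X  only when X is not a value.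
  data Lifts {Γ} : ∀ {σ τ} {S S' : Stack Γ σ τ} → S ⇒ˢ S' → Set where
    liftˡ : ∀ {Δ ρ τ τ'} {H : ArgsHole Γ Δ ρ} {B : Tm Δ τ} {v : Value B} {S : Stack Γ (□ τ) τ'} →
            Lifts (liftˢ {H = H} {B = B} {v = v} {S = S})
    tailˡ : ∀ {σ ρ τ} {F : Frame Γ σ ρ} {S S' : Stack Γ ρ τ} {p : S ⇒ˢ S'} → Lifts p → Lifts (tailˢ {F = F} p)

  lifts? : ∀ {Γ σ τ} {S S' : Stack Γ σ τ} (p : S ⇒ˢ S') → Dec (Lifts p)
  lifts? liftˢ     = yes liftˡ
  lifts? (tailˢ p) with lifts? p
  ... | yes l = yes (tailˡ l)
  ... | no ¬l = no λ { (tailˡ l) → ¬l l }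
  lifts? (let-bodyˢ _)  = no λ ()
  lifts? let-varˢ       = no λ ()
  lifts? let-assocˢ     = no λ ()
  lifts? (box-bodyˢ _)  = no λ ()
  lifts? (box-argsˢ _)  = no λ ()
  lifts? box-mergeˢ     = no λ ()
  lifts? box-varˢ       = no λ ()
  lifts? box-box-mergeˢ = no λ ()

  plug-⇒ˢ-nonlifting : ∀ {Γ σ τ} {S S' : Stack Γ σ τ} (p : S ⇒ˢ S') → ¬ Lifts p →
                       (X : Tm Γ σ) → plug S X →c plug S' X
  plug-⇒ˢ-nonlifting (let-bodyˢ {S = S} r) _ X = plug-→c S (ξ-letʳ r)
  plug-⇒ˢ-nonlifting (let-varˢ {S = S})    _ X = plug-→c S let-var
  plug-⇒ˢ-nonlifting (let-assocˢ {S = S})  _ X = plug-→c S let-assoc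
  plug-⇒ˢ-nonlifting (box-bodyˢ {S = S} r) _ X = plug-→c S (ξ-box-body r)
  plug-⇒ˢ-nonlifting (box-argsˢ {S = S} p) _ X = plug-→c S (ξ-box-arg (fill-⇒ʰ p X))
  plug-⇒ˢ-nonlifting (box-mergeˢ {Ws = Ws} {ws} {Ns} {ns} {V} {vV} {H} {M} {vM} {vM'} {S}) _ X =
    plug-→c S (subst₂ _→c_
      (cong (λ Xs → box Xs M vM) (sym (fill-prepend Ws ws (cons (box Ns V vV) (vbox ns) H) X)))
      (cong (λ Xs → box Xs _ vM') (sym (trans (fill-prepend Ws ws (prepend Ns ns H) X)
                                               (cong (Ws ++ᵃ_) (fill-prepend Ns ns H X)))))
      (box-merge {vM' = vM'} ws))
  plug-⇒ˢ-nonlifting (box-varˢ {S = S}) _ X = plug-→c S box-var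
  plug-⇒ˢ-nonlifting liftˢ ¬l X = ⊥-elim (¬l liftˡ)
  plug-⇒ˢ-nonlifting (box-box-mergeˢ {H = H} {B} {v} {Ws} {ws} {Ps} {M} {vM} {vM'} {S}) _ X =
    plug-→c S (subst₂ _→c_
      (cong (λ Xs → box Xs M vM) (sym (fill-prepend Ws ws (hole Ps) (box (fill H X) B v))))
      (cong (λ Xs → box Xs _ vM') (sym (trans (fill-prepend Ws ws (append H Ps) X)
                                               (cong (Ws ++ᵃ_) (fill-append H Ps X)))))
      (box-merge {vM' = vM'} ws))
  plug-⇒ˢ-nonlifting (tailˢ {F = F} p) ¬l X = plug-⇒ˢ-nonlifting p (¬l ∘ tailˡ) (plugF F X)

  plug-⇒ˢ-lifting : ∀ {Γ σ τ} {S S' : Stack Γ σ τ} {p : S ⇒ˢ S'} → Lifts p →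
                    (X : Tm Γ σ) → ¬ Value X → plug S X →c plug S' X
  plug-⇒ˢ-lifting (liftˡ {H = H} {B} {v} {S}) X ¬x = plug-→c S (lift-box-hole H ¬x B v)
  plug-⇒ˢ-lifting (tailˡ {F = F} l)           X ¬x = plug-⇒ˢ-lifting l (plugF F X) (plugF-nonvalue F ¬x)

  plug-⇒ˢ : ∀ {Γ σ τ} {S S' : Stack Γ σ τ} → S ⇒ˢ S' → (X : Tm Γ σ) → ¬ Value X → plug S X →c plug S' X
  plug-⇒ˢ p X ¬x with lifts? p
  ... | yes l = plug-⇒ˢ-lifting l X ¬x
  ... | no ¬l = plug-⇒ˢ-nonlifting p ¬l X

  boxFrames-⇒ˢ : ∀ {Γ σ τ} {S S' : Stack Γ σ τ} → S ⇒ˢ S' → boxFrames S' ≤ boxFrames S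
  boxFrames-⇒ˢ (let-bodyˢ _)  = ≤-refl
  boxFrames-⇒ˢ let-varˢ       = ≤-refl
  boxFrames-⇒ˢ let-assocˢ     = ≤-refl
  boxFrames-⇒ˢ (box-bodyˢ _)  = ≤-refl
  boxFrames-⇒ˢ (box-argsˢ _)  = ≤-refl
  boxFrames-⇒ˢ box-mergeˢ     = ≤-refl
  boxFrames-⇒ˢ box-varˢ       = n≤1+n _
  boxFrames-⇒ˢ liftˢ          = n≤1+n _
  boxFrames-⇒ˢ box-box-mergeˢ = n≤1+n _
  boxFrames-⇒ˢ (tailˢ {F = letF _} p)     = boxFrames-⇒ˢ p
  boxFrames-⇒ˢ (tailˢ {F = boxF _ _ _} p) = s≤s (boxFrames-⇒ˢ p)

  boxFrames-lifting : ∀ {Γ σ τ} {S S' : Stack Γ σ τ} {p : S ⇒ˢ S'} → Lifts p → boxFrames S' < boxFrames S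
  boxFrames-lifting liftˡ                     = n<1+n _
  boxFrames-lifting (tailˡ {F = letF _} l)     = boxFrames-lifting l
  boxFrames-lifting (tailˡ {F = boxF _ _ _} l) = s≤s (boxFrames-lifting l)

  renStack-⇒ˢ : ∀ {Γ Δ σ τ} (ρ : Ren Γ Δ) {S S' : Stack Γ σ τ} → S ⇒ˢ S' → renStack ρ S ⇒ˢ renStack ρ S'
  renStack-⇒ˢ ρ (let-bodyˢ r) = let-bodyˢ (ren-→c (liftR ρ) r)
  renStack-⇒ˢ ρ let-varˢ      = let-varˢ
  renStack-⇒ˢ ρ (let-assocˢ {C = C} {E} {S}) =
    subst₂ _⇒ˢ_ refl (cong (λ c → letF (lett (ren (liftR ρ) C) c) ▷ renStack ρ S) (liftR-there-comm E)) let-assocˢ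
    where
    liftR-there-comm : ∀ {ρ₁ ρ₂ σ₁} (E : Tm (ρ₁ ∷ _) ρ₂) →
                       ren (liftR (there {τ = σ₁})) (ren (liftR ρ) E) ≡ ren (liftR (liftR ρ)) (ren (liftR there) E)
    liftR-there-comm E =
      trans (ren-∘ _ _ E) (trans (ren-cong (λ { here → refl ; (there x) → refl }) E) (sym (ren-∘ _ _ E)))
  renStack-⇒ˢ ρ (box-bodyˢ r) = box-bodyˢ r
  renStack-⇒ˢ ρ (box-argsˢ p) = box-argsˢ (renHole-⇒ʰ ρ p)
  renStack-⇒ˢ ρ (box-mergeˢ {Ws = Ws} {ws} {Ns} {ns} {V} {vV} {H} {M} {vM} {vM'} {S}) =
    subst₂ _⇒ˢ_
      (cong (λ h → boxF h M vM ▷ renStack ρ S) (sym (renHole-prepend ρ Ws ws (cons (box Ns V vV) (vbox ns) H))))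
      (cong (λ h → boxF h _ vM' ▷ renStack ρ S)
            (sym (trans (renHole-prepend ρ Ws ws (prepend Ns ns H)) (cong (prepend _ _) (renHole-prepend ρ Ns ns H)))))
      (box-mergeˢ {vM' = vM'})
  renStack-⇒ˢ ρ box-varˢ = box-varˢ
  renStack-⇒ˢ ρ (liftˢ {H = H} {B} {v} {S}) =
    subst₂ _⇒ˢ_ refl (cong (λ Xs → letF (box Xs B v) ▷ renStack ρ S) (sym lift-ren)) liftˢ
    where
    lift-ren : renArgs (liftR ρ) (fill (renHole there H) (var here)) ≡ fill (renHole there (renHole ρ H)) (var here)
    lift-ren = trans (fill-ren (liftR ρ) (renHole there H) (var here))
                     (cong (λ h → fill h (var here)) (trans (renHole-∘ (liftR ρ) there H) (sym (renHole-∘ there ρ H))))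
  renStack-⇒ˢ ρ (box-box-mergeˢ {H = H} {B} {v} {Ws} {ws} {Ps} {M} {vM} {vM'} {S}) =
    subst₂ _⇒ˢ_
      (cong (λ h → boxF (renHole ρ H) B v ▷ boxF h M vM ▷ renStack ρ S) (sym (renHole-prepend ρ Ws ws (hole Ps))))
      (cong (λ h → boxF h _ vM' ▷ renStack ρ S)
            (sym (trans (renHole-prepend ρ Ws ws (append H Ps)) (cong (prepend _ _) (renHole-append ρ H Ps)))))
      (box-box-mergeˢ {vM' = vM'})
  renStack-⇒ˢ ρ (tailˢ p) = tailˢ (renStack-⇒ˢ ρ p)

  data PlugStep {Γ σ τ} (S : Stack Γ σ τ) (X : Tm Γ σ) (Y : Tm Γ τ) : Set where
    inside  : ∀ {X'} → X →c X' → Y ≡ plug S X' → PlugStep S X Y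
    outside : ∀ {S'} → S ⇒ˢ S' → Y ≡ plug S' X → PlugStep S X Y
    assoc   : ∀ {ρ ρ'} {L : Tm Γ ρ} {N : Tm (ρ ∷ Γ) σ} {C : Tm (σ ∷ Γ) ρ'} {S' : Stack Γ ρ' τ} →
              X ≡ lett L N → S ≡ letF C ▷ S' → Y ≡ plug S' (lett L (lett N (ren (liftR there) C))) →
              PlugStep S X Y
    -- one equation between triples, since σ is determined only through X
    merge   : ∀ {Δw Δy Δz ρ τ'} {Ws : Args Γ Δw} {ws : Values Ws} {Ns : Args Γ Δy} {V : Tm Δy ρ}
                {vV : Value V} {Ps : Args Γ Δz} {M : Tm (Δw ++ ρ ∷ Δz) τ'} {vM : Value M}
                {vM' : Value (sub (mergeSub Δw V) M)} {S' : Stack Γ (□ τ') τ} →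
              _≡_ {A = Σ Ty (λ r → Tm Γ r × Stack Γ r τ)}
                  (σ , X , S) (□ ρ , box Ns V vV , (boxF (prepend Ws ws (hole Ps)) M vM ▷ S')) →
              Y ≡ plug S' (box (Ws ++ᵃ (Ns ++ᵃ Ps)) (sub (mergeSub Δw V) M) vM') → PlugStep S X Y

  head-arg : ∀ {Γ σ Ξ} → Args Γ (σ ∷ Ξ) → Tm Γ (□ σ)
  head-arg (N ∷ _) = N

  tail-arg : ∀ {Γ σ Ξ} → Args Γ (σ ∷ Ξ) → Args Γ Ξ
  tail-arg (_ ∷ Ns) = Ns

  fill-→cᵃ⁻ : ∀ {Γ Δ ρ} (H : ArgsHole Γ Δ ρ) (X : Tm Γ (□ ρ)) {Xs' : Args Γ Δ} → fill H X →cᵃ Xs' →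
              (Σ (Tm Γ (□ ρ)) λ X' → (X →c X') × (Xs' ≡ fill H X')) ⊎
              (Σ (ArgsHole Γ Δ ρ) λ H' → (H ⇒ʰ H') × (Xs' ≡ fill H' X))
  fill-→cᵃ⁻ (hole Ms)     X (hd r)  = inj₁ (_ , r , refl)
  fill-→cᵃ⁻ (hole Ms)     X (tl rs) = inj₂ (_ , restʰ rs , refl)
  fill-→cᵃ⁻ (cons W w H) X (hd r)  = inj₂ (cons _ (value-→c w r) H , headʰ r , refl)
  fill-→cᵃ⁻ (cons W w H) X (tl rs) with fill-→cᵃ⁻ H X rs
  ... | inj₁ (X' , r , e) = inj₁ (X' , r , cong (W ∷_) e)
  ... | inj₂ (H' , p , e) = inj₂ (cons W w H' , tailʰ p , cong (W ∷_) e)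

  -- A sequence has only one non-value in front of which all arguments are values.
  lift-box-fill : ∀ {Γ Δ₁ Δ₂ ρ₁ ρ} (Vs : Args Γ Δ₁) → Values Vs → {A : Tm Γ (□ ρ₁)} → ¬ Value A →
                  {Ms : Args Γ Δ₂} (H : ArgsHole Γ (Δ₁ ++ ρ₁ ∷ Δ₂) ρ) → {X : Tm Γ (□ ρ)} → ¬ Value X →
                  Vs ++ᵃ (A ∷ Ms) ≡ fill H X →
                  _≡_ {A = Σ Ty (λ r → Tm Γ (□ r) × Args (□ r ∷ Γ) (Δ₁ ++ ρ₁ ∷ Δ₂))}
                      (ρ₁ , A , wkArgs Vs ++ᵃ (var here ∷ wkArgs Ms)) (ρ , X , fill (renHole there H) (var here))
  lift-box-fill []       []       ¬a (hole Ms')    ¬x refl = refl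
  lift-box-fill []       []       ¬a (cons W w H) ¬x eq   = ⊥-elim (¬a (subst Value (sym (cong head-arg eq)) w))
  lift-box-fill (V ∷ Vs) (v ∷ vs) ¬a (hole Ms')    ¬x eq   = ⊥-elim (¬x (subst Value (cong head-arg eq) v))
  lift-box-fill (V ∷ Vs) (v ∷ vs) ¬a (cons W w H) ¬x eq with cong head-arg eq
  ... | refl = cong (λ { (r , a , as) → r , a , wk V ∷ as }) (lift-box-fill Vs vs ¬a H ¬x (cong tail-arg eq))

  box-values⁻ : ∀ {Γ Δ τ} {Ns : Args Γ Δ} {V : Tm Δ τ} {vV : Value V} → Value (box Ns V vV) → Values Ns
  box-values⁻ (vbox ns) = ns

  box-merge-fill : ∀ {Γ Δw Δy Δz σ ρ} (Ws : Args Γ Δw) (ws : Values Ws) {Ns : Args Γ Δy} {V : Tm Δy σ}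
                   {vV : Value V} {Ps : Args Γ Δz} (H : ArgsHole Γ (Δw ++ σ ∷ Δz) ρ) {X : Tm Γ (□ ρ)} →
                   ¬ Value X → Ws ++ᵃ (box Ns V vV ∷ Ps) ≡ fill H X →
                   (Σ (ArgsHole Γ Δz ρ) λ H₂ → Σ (Values Ns) λ ns →
                      (H ≡ prepend Ws ws (cons (box Ns V vV) (vbox ns) H₂)) × (Ps ≡ fill H₂ X)) ⊎
                   (_≡_ {A = Σ Ty (λ r → Tm Γ (□ r) × ArgsHole Γ (Δw ++ σ ∷ Δz) r)}
                        (ρ , X , H) (σ , box Ns V vV , prepend Ws ws (hole Ps)))
  box-merge-fill []        []        (hole Ms)       ¬x refl = inj₂ refl
  box-merge-fill []        []        (cons W w H₂)  ¬x eq with cong head-arg eq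
  ... | refl = inj₁ (H₂ , box-values⁻ w , cong (λ a → cons W a H₂) (value-irrelevant w (vbox (box-values⁻ w)))
                    , cong tail-arg eq)
  box-merge-fill (W' ∷ Ws) (w' ∷ ws) (hole Ms)      ¬x eq = ⊥-elim (¬x (subst Value (cong head-arg eq) w'))
  box-merge-fill (W' ∷ Ws) (w' ∷ ws) (cons W w H) {X} ¬x eq
    with cong head-arg eq | box-merge-fill Ws ws H ¬x (cong tail-arg eq)
  ... | refl | inj₁ (H₂ , ns , e₁ , e₂) = inj₁ (H₂ , ns , cong₂ (cons W') (value-irrelevant w w') e₁ , e₂)
  ... | refl | inj₂ e = inj₂ (trans (cong (λ a → _ , X , cons W' a H) (value-irrelevant w w'))
                                    (cong (λ { (r , x , h) → r , x , cons W' w' h }) e))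

  plug-box-step : ∀ {Γ Δ ρ τ τ'} (S : Stack Γ (□ τ) τ') (H : ArgsHole Γ Δ ρ) (B : Tm Δ τ) (v : Value B)
                  (X : Tm Γ (□ ρ)) → ¬ Value X → ∀ {Xs Y₁ Y} → Xs ≡ fill H X → box Xs B v →c Y₁ →
                  Y ≡ plug S Y₁ → PlugStep (boxF H B v ▷ S) X Y
  plug-box-step S H B v X ¬x eqXs (ξ-box-arg rs) e with fill-→cᵃ⁻ H X (subst (_→cᵃ _) eqXs rs)
  ... | inj₁ (X' , r' , e') = inside r' (trans e (cong (λ a → plug S (box a B v)) e'))
  ... | inj₂ (H' , p , e')  = outside (box-argsˢ p) (trans e (cong (λ a → plug S (box a B v)) e'))
  plug-box-step S H B v X ¬x eqXs (ξ-box-body {v' = v'} r') e =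
    outside (box-bodyˢ r') (trans e (cong (λ a → plug S (box a _ v')) eqXs))
  plug-box-step S (hole [])      _ _ X ¬x refl box-var e = outside box-varˢ e
  plug-box-step S (cons W w ()) _ _ X ¬x eqXs box-var e
  plug-box-step S H B v X ¬x eqXs (lift-box {Vs = Vs} vs ¬a) e =
    outside liftˢ (trans e (cong (λ { (r , a , as) → plug S (lett a (box as B v)) }) (lift-box-fill Vs vs ¬a H ¬x eqXs)))
  plug-box-step S H _ _ X ¬x eqXs (box-merge {Ws = Ws} {Ns = Ns} {vV = vV} {vM' = vM'} ws) e
    with box-merge-fill Ws ws H ¬x eqXs
  ... | inj₁ (H₂ , ns , refl , e₂) =
    outside (box-mergeˢ {vM' = vM'})
      (trans e (cong (λ a → plug S (box a _ vM'))
        (sym (trans (fill-prepend Ws ws (prepend Ns ns H₂) X)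
                    (cong (Ws ++ᵃ_) (trans (fill-prepend Ns ns H₂ X) (cong (Ns ++ᵃ_) (sym e₂))))))))
  ... | inj₂ eΣ = merge {vM' = vM'} (cong (λ { (r , x , h) → □ r , x , (boxF h _ _ ▷ S) }) eΣ) e

  plug-step : ∀ {Γ σ τ} (S : Stack Γ σ τ) (X : Tm Γ σ) → ¬ Value X → ∀ {Y} → plug S X →c Y → PlugStep S X Y
  plug-step ε       X ¬x r = inside r refl
  plug-step (F ▷ S) X ¬x r with plug-step S (plugF F X) (plugF-nonvalue F ¬x) r
  plug-step (letF C ▷ S)     X ¬x r | inside (ξ-letˡ r') e = inside r' e
  plug-step (letF C ▷ S)     X ¬x r | inside (ξ-letʳ r') e = outside (let-bodyˢ r') e
  plug-step (letF C ▷ S)     X ¬x r | inside let-var e     = outside let-varˢ e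
  plug-step (letF C ▷ S)     X ¬x r | inside (let-val v) e = ⊥-elim (¬x v)
  plug-step (letF C ▷ S)     X ¬x r | inside let-assoc e   = assoc refl refl e
  plug-step (boxF H B v ▷ S) X ¬x r | inside r' e          = plug-box-step S H B v X ¬x refl r' e
  plug-step (F ▷ S)          X ¬x r | outside p e          = outside (tailˢ p) e
  plug-step (letF C ▷ S)     X ¬x r | assoc refl refl e    = outside let-assocˢ e
  plug-step (boxF H B v ▷ S) X ¬x r | assoc () _ _
  plug-step (letF C ▷ S)     X ¬x r | merge () _
  plug-step (boxF H B v ▷ S) X ¬x r | merge {Ws = Ws} {ws = ws} {Ps = Ps} {vM' = vM'} {S' = S'} refl e =
    outside (box-box-mergeˢ {vM' = vM'})
      (trans e (cong (λ a → plug S' (box a _ vM'))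
                     (sym (trans (fill-prepend Ws ws (append H Ps) X) (cong (Ws ++ᵃ_) (fill-append H Ps X))))))

  SNStack : ∀ {Γ σ τ} → Stack Γ σ τ → Set
  SNStack = Acc (flip _⇒ˢ_)

  SN-plug⇒SNStack : ∀ {Γ σ τ} (S : Stack Γ σ τ) (M : Tm Γ σ) → ¬ Value M → SN (plug S M) → SNStack S
  SN-plug⇒SNStack S M ¬m (acc h) = acc λ p → SN-plug⇒SNStack _ M ¬m (h (plug-⇒ˢ p M ¬m))

  SNStack-ren⁻ : ∀ {Γ Δ σ τ} (ρ : Ren Γ Δ) {S : Stack Γ σ τ} → SNStack (renStack ρ S) → SNStack S
  SNStack-ren⁻ ρ (acc h) = acc λ p → SNStack-ren⁻ ρ (h (renStack-⇒ˢ ρ p))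

  -- Backward closure of strong normalisation in a stack

  SN-expand-let-val : ∀ {n} → Acc _<_ n → ∀ {Γ σ ρ τ} {V : Tm Γ σ} → Value V → SN V →
                      ∀ {t : Tm Γ τ} → SN t → (S : Stack Γ ρ τ) → boxFrames S ≤ n →
                      {B : Tm (σ ∷ Γ) ρ} → t ≡ plug S (B [ V ]) → SN (plug S (lett V B))
  let-val-step : ∀ {n} → Acc _<_ n → ∀ {Γ σ ρ τ} {V : Tm Γ σ} → Value V → SN V →
                 ∀ {t : Tm Γ τ} → SN t → (S : Stack Γ ρ τ) → boxFrames S ≤ n →
                 {B : Tm (σ ∷ Γ) ρ} → t ≡ plug S (B [ V ]) → ∀ {Y} → PlugStep S (lett V B) Y → SN Y
  let-val-outside : ∀ {n} → Acc _<_ n → ∀ {Γ σ ρ τ} {V : Tm Γ σ} → Value V → SN V →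
                    ∀ {t : Tm Γ τ} → SN t → (S : Stack Γ ρ τ) → boxFrames S ≤ n →
                    {B : Tm (σ ∷ Γ) ρ} → t ≡ plug S (B [ V ]) → ∀ {S'} (p : S ⇒ˢ S') →
                    Dec (Value (B [ V ])) → Dec (Lifts p) → SN (plug S' (lett V B))
  SN-lifting-value : ∀ {n} → Acc _<_ n → ∀ {Γ σ τ} {S S' : Stack Γ σ τ} {p : S ⇒ˢ S'} → Lifts p →
                     boxFrames S ≤ n → ∀ {W} → Value W → SN (plug S W) → SN (plug S' W)

  SN-expand-let-val a v snV snt S le {B} eq =
    acc λ r → let-val-step a v snV snt S le eq (plug-step S (lett _ B) (λ ()) r)

  let-val-step a v snV snt S le eq (inside let-var e)     = subst SN (trans eq (sym e)) snt
  let-val-step a v snV snt S le eq (inside (let-val _) e) = subst SN (trans eq (sym e)) snt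
  let-val-step a () snV snt S le eq (inside let-assoc e)
  let-val-step a v (acc hV) snt S le {B} eq (inside (ξ-letˡ r) e) =
    subst SN (sym e) (SN-expand-let-val a (value-→c v r) (hV r)
      (SN-→* snt (subst (λ u → u →* _) (sym eq) (gmap (plug S) (plug-→c S) ([]-→* B r)))) S le refl)
  let-val-step a v snV (acc h) S le eq (inside (ξ-letʳ r) e) =
    subst SN (sym e) (SN-expand-let-val a v snV
      (h (subst₂ _→c_ (sym eq) refl (plug-→c S (sub-→c (single-value v) r)))) S le refl)
  let-val-step a {V = V} v snV snt S le {B} eq (outside p e) =
    subst SN (sym e) (let-val-outside a v snV snt S le eq p (value? (B [ V ])) (lifts? p))
  let-val-step a {V = V} v snV snt (letF C ▷ S) le {B} eq (assoc refl refl e) =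
    subst SN (sym e) (SN-expand-let-val a v snV snt S le
      (trans eq (cong (λ c → plug S (lett (B [ V ]) c)) (sym assoc-[]))))
    where
    assoc-[] : sub (liftS (single V)) (ren (liftR there) C) ≡ C
    assoc-[] = trans (sub-ren _ _ C) (trans (sub-cong (λ { here → refl ; (there x) → refl }) C) (sub-id C))
  let-val-step a v snV snt S le eq (merge () _)

  let-val-outside a {V = V} v snV (acc h) S le {B} eq {S'} p (no ¬bv) _ =
    SN-expand-let-val a v snV (h (subst₂ _→c_ (sym eq) refl (plug-⇒ˢ p (B [ V ]) ¬bv)))
                      S' (≤-trans (boxFrames-⇒ˢ p) le) {B} refl
  let-val-outside a {V = V} v snV (acc h) S le {B} eq {S'} p (yes _) (no ¬l) =
    SN-expand-let-val a v snV (h (subst₂ _→c_ (sym eq) refl (plug-⇒ˢ-nonlifting p ¬l (B [ V ]))))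
                      S' (≤-trans (boxFrames-⇒ˢ p) le) {B} refl
  let-val-outside (acc rs) v snV snt S le {B} eq {S'} p (yes bv) (yes l) =
    SN-expand-let-val (rs (<-≤-trans (boxFrames-lifting l) le)) v snV
                      (SN-lifting-value (acc rs) l le bv (subst SN eq snt)) S' ≤-refl {B} refl

  SN-lifting-value (acc rs) (liftˡ {H = H} {B} {v} {S}) le {W} w snt =
    SN-expand-let-val (rs le) w (SN-plug⁻ (boxF H B v ▷ S) snt) snt S ≤-refl
                      (cong (λ Xs → plug S (box Xs B v)) (sym (fill-wk-[] H W)))
  SN-lifting-value a (tailˡ {F = F} {S} l) le {W} w snt with value? (plugF F W)
  ... | yes fw = SN-lifting-value a l (≤-trans (boxFrames-▷ F S) le) fw snt
  ... | no ¬fw = SN-→c snt (plug-⇒ˢ-lifting l (plugF F W) ¬fw)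

  data Head {Γ σ} : Tm Γ σ → Set where
    var : ∀ {x} → Head (var x)
    con : ∀ {c} → Head (con c)

  head-value : ∀ {Γ σ} {M : Tm Γ σ} → Head M → Value M
  head-value var = vvar
  head-value con = vcon

  head-irreducible : ∀ {Γ σ} {M N : Tm Γ σ} → Head M → ¬ (M →c N)
  head-irreducible var ()
  head-irreducible con ()

  ren-head : ∀ {Γ Δ σ} (ρ : Ren Γ Δ) {M : Tm Γ σ} → Head M → Head (ren ρ M)
  ren-head ρ var = var
  ren-head ρ con = con

  SN-head : ∀ {Γ σ} {M : Tm Γ σ} → Head M → SN M
  SN-head h = acc λ r → ⊥-elim (head-irreducible h r)

  SN-neutral-app : ∀ {Γ σ τ ρ} {H : Tm Γ (σ ⊃ τ)} → Head H → {S : Stack Γ τ ρ} → SNStack S →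
                   {W : Tm Γ σ} → Value W → SN W → SN (plug S (app H W))
  SN-neutral-app h {S} snS w snW = acc λ r → step h snS w snW (plug-step S _ (λ ()) r)
    where
    step : ∀ {Γ σ τ ρ} {H : Tm Γ (σ ⊃ τ)} → Head H → {S : Stack Γ τ ρ} → SNStack S →
           {W : Tm Γ σ} → Value W → SN W → ∀ {Y} → PlugStep S (app H W) Y → SN Y
    step h snS      w snW      (inside (ξ-appˡ r) e)       = ⊥-elim (head-irreducible h r)
    step h snS      w (acc hW) (inside (ξ-appʳ r) e)       = subst SN (sym e) (SN-neutral-app h snS (value-→c w r) (hW r))
    step () snS     w snW      (inside (beta _) e)
    step h snS      w snW      (inside (lift-appˡ ¬h) e)    = ⊥-elim (¬h (head-value h))
    step h snS      w snW      (inside (lift-appʳ _ ¬w) e)  = ⊥-elim (¬w w)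
    step h (acc hS) w snW      (outside p e)               = subst SN (sym e) (SN-neutral-app h (hS p) w snW)
    step h snS      w snW      (assoc () _ _)
    step h snS      w snW      (merge () _)

  SN-expand-lift-appˡ : ∀ {Γ σ τ ρ} (S : Stack Γ τ ρ) (M : Tm Γ (σ ⊃ τ)) (N : Tm Γ σ) {t} → SN t →
                        t ≡ plug S (lett M (app (var here) (wk N))) → SN (plug S (app M N))
  SN-expand-lift-appˡ S M N snt eq with value? M
  ... | yes v = SN-→c snt (subst₂ _→c_ (sym eq) (cong (λ n → plug S (app M n)) (wk-[] N M))
                                       (plug-→c S (let-val v)))
  ... | no ¬v = acc λ r → step snt eq ¬v (plug-step S _ (λ ()) r)
    where
    step : ∀ {t} → SN t → t ≡ plug S (lett M (app (var here) (wk N))) → ¬ Value M →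
           ∀ {Y} → PlugStep S (app M N) Y → SN Y
    step (acc h) eq ¬v (inside (ξ-appˡ {M' = M'} r) e) =
      subst SN (sym e) (SN-expand-lift-appˡ S M' N (h (subst₂ _→c_ (sym eq) refl (plug-→c S (ξ-letˡ r)))) refl)
    step (acc h) eq ¬v (inside (ξ-appʳ {N' = N'} r) e) =
      subst SN (sym e) (SN-expand-lift-appˡ S M N'
        (h (subst₂ _→c_ (sym eq) refl (plug-→c S (ξ-letʳ (ξ-appʳ (ren-→c there r)))))) refl)
    step snt eq ¬v (inside (beta _) e)        = ⊥-elim (¬v vlam)
    step snt eq ¬v (inside (lift-appˡ _) e)   = subst SN (trans eq (sym e)) snt
    step snt eq ¬v (inside (lift-appʳ v _) e) = ⊥-elim (¬v v)
    step (acc h) eq ¬v (outside {S' = S'} p e) =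
      subst SN (sym e) (SN-expand-lift-appˡ S' M N (h (subst₂ _→c_ (sym eq) refl (plug-⇒ˢ p _ (λ ())))) refl)
    step snt eq ¬v (assoc () _ _)
    step snt eq ¬v (merge () _)

  SN-expand-lift-appʳ : ∀ {Γ σ τ ρ} (S : Stack Γ τ ρ) (V : Tm Γ (σ ⊃ τ)) (N : Tm Γ σ) → Value V → ∀ {t} → SN t →
                        t ≡ plug S (lett N (app (wk V) (var here))) → SN (plug S (app V N))
  SN-expand-lift-appʳ S V N v snt eq with value? N
  ... | yes w = SN-→c snt (subst₂ _→c_ (sym eq) (cong (λ m → plug S (app m N)) (wk-[] V N))
                                       (plug-→c S (let-val w)))
  ... | no ¬w = acc λ r → step snt eq ¬w (plug-step S _ (λ ()) r)
    where
    step : ∀ {t} → SN t → t ≡ plug S (lett N (app (wk V) (var here))) → ¬ Value N →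
           ∀ {Y} → PlugStep S (app V N) Y → SN Y
    step (acc h) eq ¬w (inside (ξ-appˡ {M' = V'} r) e) =
      subst SN (sym e) (SN-expand-lift-appʳ S V' N (value-→c v r)
        (h (subst₂ _→c_ (sym eq) refl (plug-→c S (ξ-letʳ (ξ-appˡ (ren-→c there r)))))) refl)
    step (acc h) eq ¬w (inside (ξ-appʳ {N' = N'} r) e) =
      subst SN (sym e) (SN-expand-lift-appʳ S V N' v (h (subst₂ _→c_ (sym eq) refl (plug-→c S (ξ-letˡ r)))) refl)
    step snt eq ¬w (inside (beta w) e)         = ⊥-elim (¬w w)
    step snt eq ¬w (inside (lift-appˡ ¬v) e)   = ⊥-elim (¬v v)
    step snt eq ¬w (inside (lift-appʳ _ _) e)  = subst SN (trans eq (sym e)) snt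
    step (acc h) eq ¬w (outside {S' = S'} p e) =
      subst SN (sym e) (SN-expand-lift-appʳ S' V N v (h (subst₂ _→c_ (sym eq) refl (plug-⇒ˢ p _ (λ ())))) refl)
    step snt eq ¬w (assoc () _ _)
    step snt eq ¬w (merge () _)

  SN-expand-β : ∀ {n} → Acc _<_ n → ∀ {Γ σ τ ρ} (S : Stack Γ τ ρ) → boxFrames S ≤ n → (B : Tm (σ ∷ Γ) τ)
                (W : Tm Γ σ) → Value W → SN W → ∀ {t} → SN t → t ≡ plug S (B [ W ]) → SN (plug S (app (lam B) W))
  β-step : ∀ {n} → Acc _<_ n → ∀ {Γ σ τ ρ} (S : Stack Γ τ ρ) → boxFrames S ≤ n → (B : Tm (σ ∷ Γ) τ)
           (W : Tm Γ σ) → Value W → SN W → ∀ {t} → SN t → t ≡ plug S (B [ W ]) →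
           ∀ {Y} → PlugStep S (app (lam B) W) Y → SN Y
  β-outside : ∀ {n} → Acc _<_ n → ∀ {Γ σ τ ρ} (S : Stack Γ τ ρ) → boxFrames S ≤ n → (B : Tm (σ ∷ Γ) τ)
              (W : Tm Γ σ) → Value W → SN W → ∀ {t} → SN t → t ≡ plug S (B [ W ]) → ∀ {S'} (p : S ⇒ˢ S') →
              Dec (Value (B [ W ])) → Dec (Lifts p) → SN (plug S' (app (lam B) W))

  SN-expand-β a S le B W w snW snt eq = acc λ r → β-step a S le B W w snW snt eq (plug-step S _ (λ ()) r)

  β-step a S le B W w snW (acc h) eq (inside (ξ-appˡ (ξ-lam {M' = B'} r)) e) =
    subst SN (sym e) (SN-expand-β a S le B' W w snW
      (h (subst₂ _→c_ (sym eq) refl (plug-→c S (sub-→c (single-value w) r)))) refl)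
  β-step a S le _ W w snW snt eq (inside (ξ-appˡ (eta {V = V} _)) e) =
    subst SN (trans eq (trans (cong (λ m → plug S (app m W)) (wk-[] V W)) (sym e))) snt
  β-step a S le B W w (acc hW) snt eq (inside (ξ-appʳ {N' = W'} r) e) =
    subst SN (sym e) (SN-expand-β a S le B W' (value-→c w r) (hW r)
      (SN-→* snt (subst (λ u → u →* _) (sym eq) (gmap (plug S) (plug-→c S) ([]-→* B r)))) refl)
  β-step a S le B W w snW snt eq (inside (beta _) e)         = subst SN (trans eq (sym e)) snt
  β-step a S le B W w snW snt eq (inside (lift-appˡ ¬v) e)   = ⊥-elim (¬v vlam)
  β-step a S le B W w snW snt eq (inside (lift-appʳ _ ¬w) e) = ⊥-elim (¬w w)
  β-step a S le B W w snW snt eq (outside p e) =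
    subst SN (sym e) (β-outside a S le B W w snW snt eq p (value? (B [ W ])) (lifts? p))
  β-step a S le B W w snW snt eq (assoc () _ _)
  β-step a S le B W w snW snt eq (merge () _)

  β-outside a S le B W w snW (acc h) eq {S'} p (no ¬bw) _ =
    SN-expand-β a S' (≤-trans (boxFrames-⇒ˢ p) le) B W w snW
                (h (subst₂ _→c_ (sym eq) refl (plug-⇒ˢ p (B [ W ]) ¬bw))) refl
  β-outside a S le B W w snW (acc h) eq {S'} p (yes _) (no ¬l) =
    SN-expand-β a S' (≤-trans (boxFrames-⇒ˢ p) le) B W w snW
                (h (subst₂ _→c_ (sym eq) refl (plug-⇒ˢ-nonlifting p ¬l (B [ W ])))) refl
  β-outside (acc rs) S le B W w snW snt eq {S'} p (yes bw) (yes l) =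
    SN-expand-β (rs (<-≤-trans (boxFrames-lifting l) le)) S' ≤-refl B W w snW
                (SN-lifting-value (acc rs) l le bw (subst SN eq snt)) refl

  -- Realisations of box values

  data Real {Γ Θ τ} : Tm Γ (□ τ) → Tm Θ τ → Set
  data RealArgs {Γ Θ} : ∀ {Δ} → Args Γ Δ → Sub Δ Θ → Set
  data Real {Γ Θ τ} where
    rvar : ∀ {x : Γ ∋ □ τ} {z : Θ ∋ τ} → Real (var x) (var z)
    rcon : ∀ {c : K (□ τ)} {z : Θ ∋ τ} → Real (con c) (var z)
    rbox : ∀ {Δ} {Ws : Args Γ Δ} {B : Tm Δ τ} {v : Value B} {s : Sub Δ Θ} {U : Tm Θ τ} →
           RealArgs Ws s → U ≡ sub s B → Real (box Ws B v) U
  data RealArgs {Γ Θ} where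
    rnil  : ∀ {s : Sub [] Θ} → RealArgs [] s
    rcons : ∀ {σ Δ} {W : Tm Γ (□ σ)} {Ws : Args Γ Δ} {s : Sub (σ ∷ Δ) Θ} →
            Real W (s here) → RealArgs Ws (s ∘ there) → RealArgs (W ∷ Ws) s

  real-ren⁻ : ∀ {Γ Δ Θ τ} (ρ : Ren Γ Δ) (V : Tm Γ (□ τ)) {U : Tm Θ τ} → Real (ren ρ V) U → Real V U
  realArgs-ren⁻ : ∀ {Γ Δ Θ Ξ} (ρ : Ren Γ Δ) (Ws : Args Γ Ξ) {s : Sub Ξ Θ} →
                  RealArgs (renArgs ρ Ws) s → RealArgs Ws s
  real-ren⁻ ρ (con c)      rcon        = rcon
  real-ren⁻ ρ (var x)      rvar        = rvar
  real-ren⁻ ρ (box Ws B v) (rbox ra e) = rbox (realArgs-ren⁻ ρ Ws ra) e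
  realArgs-ren⁻ ρ []       rnil         = rnil
  realArgs-ren⁻ ρ (W ∷ Ws) (rcons r ra) = rcons (real-ren⁻ ρ W r) (realArgs-ren⁻ ρ Ws ra)

  real-ren : ∀ {Γ Θ Θ' τ} (ρ : Ren Θ Θ') {V : Tm Γ (□ τ)} {U : Tm Θ τ} → Real V U → Real V (ren ρ U)
  realArgs-ren : ∀ {Γ Θ Θ' Ξ} (ρ : Ren Θ Θ') {Ws : Args Γ Ξ} {s : Sub Ξ Θ} →
                 RealArgs Ws s → RealArgs Ws (ren ρ ∘ s)
  real-ren ρ rvar = rvar
  real-ren ρ rcon = rcon
  real-ren ρ (rbox {B = B} {s = s} ra e) = rbox (realArgs-ren ρ ra) (trans (cong (ren ρ) e) (ren-sub ρ s B))
  realArgs-ren ρ rnil         = rnil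
  realArgs-ren ρ (rcons r ra) = rcons (real-ren ρ r) (realArgs-ren ρ ra)

  real-value : ∀ {Γ Θ τ} {V : Tm Γ (□ τ)} {U : Tm Θ τ} → Real V U → Value U
  realArgs-value : ∀ {Γ Θ Ξ} {Ws : Args Γ Ξ} {s : Sub Ξ Θ} → RealArgs Ws s → ValueSub s
  real-value rvar                  = vvar
  real-value rcon                  = vvar
  real-value (rbox {v = v} ra refl) = sub-value (realArgs-value ra) v
  realArgs-value (rcons r ra) here      = real-value r
  realArgs-value (rcons r ra) (there x) = realArgs-value ra x

  real-value⁻ : ∀ {Γ Θ τ} {V : Tm Γ (□ τ)} {U : Tm Θ τ} → Real V U → Value V
  realArgs-values⁻ : ∀ {Γ Θ Ξ} {Ws : Args Γ Ξ} {s : Sub Ξ Θ} → RealArgs Ws s → Values Ws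
  real-value⁻ rvar        = vvar
  real-value⁻ rcon        = vcon
  real-value⁻ (rbox ra e) = vbox (realArgs-values⁻ ra)
  realArgs-values⁻ rnil         = []
  realArgs-values⁻ (rcons r ra) = real-value⁻ r ∷ realArgs-values⁻ ra

  realise : ∀ {Γ τ} {V : Tm Γ (□ τ)} → Value V → Σ Ctx (λ Θ → Σ (Tm Θ τ) (Real V))
  realiseArgs : ∀ {Γ Ξ} {Ws : Args Γ Ξ} → Values Ws → Σ Ctx (λ Θ → Σ (Sub Ξ Θ) (RealArgs Ws))
  realise {τ = τ} vcon = (τ ∷ []) , var here , rcon
  realise {τ = τ} vvar = (τ ∷ []) , var here , rvar
  realise (vbox {M = B} ws) with realiseArgs ws
  ... | Θ , s , ra = Θ , sub s B , rbox ra refl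
  realiseArgs [] = [] , (λ ()) , rnil
  realiseArgs (w ∷ ws) with realise w | realiseArgs ws
  ... | Θ₁ , u , r | Θ₂ , s , ra =
    (Θ₁ ++ Θ₂) , (λ { here → ren (injectˡ Θ₂) u ; (there x) → ren (raise Θ₁) (s x) }) ,
    rcons (real-ren (injectˡ Θ₂) r) (realArgs-ren (raise Θ₁) ra)

  appendSub : ∀ Δ₁ {Δ₂ Θ} → Sub Δ₁ Θ → Sub Δ₂ Θ → Sub (Δ₁ ++ Δ₂) Θ
  appendSub []       s₁ s₂ x         = s₂ x
  appendSub (_ ∷ Δ₁) s₁ s₂ here      = s₁ here
  appendSub (_ ∷ Δ₁) s₁ s₂ (there x) = appendSub Δ₁ (s₁ ∘ there) s₂ x

  appendSub-injectˡ : ∀ Δ₁ {Δ₂ Θ σ} (s₁ : Sub Δ₁ Θ) (s₂ : Sub Δ₂ Θ) (x : Δ₁ ∋ σ) →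
                      appendSub Δ₁ s₁ s₂ (injectˡ Δ₂ x) ≡ s₁ x
  appendSub-injectˡ (_ ∷ Δ₁) s₁ s₂ here      = refl
  appendSub-injectˡ (_ ∷ Δ₁) s₁ s₂ (there x) = appendSub-injectˡ Δ₁ (s₁ ∘ there) s₂ x

  appendSub-raise : ∀ Δ₁ {Δ₂ Θ σ} (s₁ : Sub Δ₁ Θ) (s₂ : Sub Δ₂ Θ) (x : Δ₂ ∋ σ) →
                    appendSub Δ₁ s₁ s₂ (raise Δ₁ x) ≡ s₂ x
  appendSub-raise []       s₁ s₂ x = refl
  appendSub-raise (_ ∷ Δ₁) s₁ s₂ x = appendSub-raise Δ₁ (s₁ ∘ there) s₂ x

  appendSub-split : ∀ Δ₁ {Δ₂ Θ} (s : Sub (Δ₁ ++ Δ₂) Θ) →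
                    appendSub Δ₁ (s ∘ injectˡ Δ₂) (s ∘ raise Δ₁) ≗ˢ s
  appendSub-split []       s x         = refl
  appendSub-split (_ ∷ Δ₁) s here      = refl
  appendSub-split (_ ∷ Δ₁) s (there x) = appendSub-split Δ₁ (s ∘ there) x

  appendSub-cong : ∀ Δ₁ {Δ₂ Θ} {s₁ s₁' : Sub Δ₁ Θ} {s₂ s₂' : Sub Δ₂ Θ} → s₁ ≗ˢ s₁' → s₂ ≗ˢ s₂' →
                   appendSub Δ₁ s₁ s₂ ≗ˢ appendSub Δ₁ s₁' s₂'
  appendSub-cong []       e₁ e₂ x         = e₂ x
  appendSub-cong (_ ∷ Δ₁) e₁ e₂ here      = e₁ here
  appendSub-cong (_ ∷ Δ₁) e₁ e₂ (there x) = appendSub-cong Δ₁ (e₁ ∘ there) e₂ x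

  realArgs-split : ∀ {Γ Θ Δ₁ Δ₂} (Xs : Args Γ Δ₁) {Ys : Args Γ Δ₂} {s : Sub (Δ₁ ++ Δ₂) Θ} →
                   RealArgs (Xs ++ᵃ Ys) s → RealArgs Xs (s ∘ injectˡ Δ₂) × RealArgs Ys (s ∘ raise Δ₁)
  realArgs-split []       ra           = rnil , ra
  realArgs-split (X ∷ Xs) (rcons r ra) = let (a , b) = realArgs-split Xs ra in rcons r a , b

  realArgs-++ : ∀ {Γ Θ Δ₁ Δ₂} {Xs : Args Γ Δ₁} {Ys : Args Γ Δ₂} {s₁ : Sub Δ₁ Θ} {s₂ : Sub Δ₂ Θ} →
                RealArgs Xs s₁ → RealArgs Ys s₂ → RealArgs (Xs ++ᵃ Ys) (appendSub Δ₁ s₁ s₂)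
  realArgs-++ rnil         rb = rb
  realArgs-++ (rcons r ra) rb = rcons r (realArgs-++ ra rb)

  infixr 5 _∷ˢ_
  _∷ˢ_ : ∀ {Δ Θ σ} → Tm Θ σ → Sub Δ Θ → Sub (σ ∷ Δ) Θ
  (u ∷ˢ s) here      = u
  (u ∷ˢ s) (there x) = s x

  sub-mergeSub : ∀ Δw {Δy Δz Θ σ} (V : Tm Δy σ) (sW : Sub Δw Θ) (sN : Sub Δy Θ) (sP : Sub Δz Θ) →
                 sub (appendSub Δw sW (appendSub Δy sN sP)) ∘ mergeSub Δw V ≗ˢ appendSub Δw sW (sub sN V ∷ˢ sP)
  sub-mergeSub [] {Δy} {Δz} V sW sN sP here =
    trans (sub-ren (appendSub Δy sN sP) (injectˡ Δz) V) (sub-cong (appendSub-injectˡ Δy sN sP) V)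
  sub-mergeSub [] {Δy} V sW sN sP (there z) = appendSub-raise Δy sN sP z
  sub-mergeSub (_ ∷ Δw) V sW sN sP here      = refl
  sub-mergeSub (_ ∷ Δw) V sW sN sP (there x) =
    trans (sub-ren _ there (mergeSub Δw V x)) (sub-mergeSub Δw V (sW ∘ there) sN sP x)

  real-→c : ∀ {Γ Θ τ} {V V' : Tm Γ (□ τ)} → V →c V' → {u : Tm Θ τ} → Real V u →
            Σ (Tm Θ τ) (λ u' → Real V' u' × (u →* u'))
  realArgs-→cᵃ : ∀ {Γ Θ Ξ} {Ws Ws' : Args Γ Ξ} → Ws →cᵃ Ws' → {s : Sub Ξ Θ} → RealArgs Ws s →
                 Σ (Sub Ξ Θ) (λ s' → RealArgs Ws' s' × s →*ˢ s')
  real-→c (ξ-box-body {M' = B'} r) (rbox {s = s} ra e) =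
    sub s B' , rbox ra refl , subst (_→* _) (sym e) (sub-→c (realArgs-value ra) r ◅ ε*)
  real-→c (ξ-box-arg {M = B} rs) (rbox ra e) with realArgs-→cᵃ rs ra
  ... | s' , ra' , p = sub s' B , rbox ra' refl , subst (_→* _) (sym e) (sub-→* p B)
  real-→c box-var (rbox (rcons r rnil) e) = _ , subst (Real _) (sym e) r , ε*
  real-→c (lift-box {Vs = Vs} vs ¬a) (rbox ra e) with realArgs-split Vs ra
  ... | _ , rcons r _ = ⊥-elim (¬a (real-value⁻ r))
  real-→c (box-merge {Δw = Δw} {Δy = Δy} {Ws = Ws} {V = V} {M = M} ws) {u} (rbox {s = s} ra e)
    with realArgs-split Ws ra
  ... | raW , rcons (rbox {s = sN} raN eN) raP =
    u , rbox (realArgs-++ raW (realArgs-++ raN raP)) merged , ε*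
    where
    merged : u ≡ sub (appendSub Δw (s ∘ injectˡ _) (appendSub Δy sN (s ∘ raise Δw ∘ there)))
                     (sub (mergeSub Δw V) M)
    merged = trans e (trans
      (sym (sub-cong (λ x → trans (appendSub-cong Δw (λ _ → refl) (λ { here → sym eN ; (there z) → refl }) x)
                                  (appendSub-split Δw s x)) M))
      (sym (trans (sub-∘ _ (mergeSub Δw V) M) (sub-cong (sub-mergeSub Δw V _ sN _) M))))
  realArgs-→cᵃ (hd r) (rcons {s = s} rW ra) with real-→c r rW
  ... | u' , rW' , p = (u' ∷ˢ s ∘ there) , rcons rW' ra , (λ { here → p ; (there x) → ε* })
  realArgs-→cᵃ (tl rs) (rcons {s = s} rW ra) with realArgs-→cᵃ rs ra
  ... | s' , ra' , ps = (s here ∷ˢ s') , rcons rW ra' , (λ { here → ε* ; (there x) → ps x })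

  -- Strong normalisation of box values

  data AllArgs {Γ} (P : ∀ {σ} → Tm Γ (□ σ) → Set) : ∀ {Δ} → Args Γ Δ → Set where
    []  : AllArgs P []
    _∷_ : ∀ {σ Δ} {W : Tm Γ (□ σ)} {Ws : Args Γ Δ} → P W → AllArgs P Ws → AllArgs P (W ∷ Ws)

  allArgs-++⁻ : ∀ {Γ} {P : ∀ {σ} → Tm Γ (□ σ) → Set} {Δ₁ Δ₂} (Xs : Args Γ Δ₁) {Ys : Args Γ Δ₂} →
                AllArgs P (Xs ++ᵃ Ys) → AllArgs P Xs × AllArgs P Ys
  allArgs-++⁻ []       ps       = [] , ps
  allArgs-++⁻ (X ∷ Xs) (p ∷ ps) = let (a , b) = allArgs-++⁻ Xs ps in (p ∷ a) , b

  allArgs-++ : ∀ {Γ} {P : ∀ {σ} → Tm Γ (□ σ) → Set} {Δ₁ Δ₂} {Xs : Args Γ Δ₁} {Ys : Args Γ Δ₂} →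
               AllArgs P Xs → AllArgs P Ys → AllArgs P (Xs ++ᵃ Ys)
  allArgs-++ []       qs = qs
  allArgs-++ (p ∷ ps) qs = p ∷ allArgs-++ ps qs

  SNArgs : ∀ {Γ Ξ} → Args Γ Ξ → Set
  SNArgs = Acc (flip _→cᵃ_)

  SNArgs-∷ : ∀ {Γ σ Ξ} {W : Tm Γ (□ σ)} {Ws : Args Γ Ξ} → SN W → SNArgs Ws → SNArgs (W ∷ Ws)
  SNArgs-∷ (acc hW) (acc hWs) = acc λ { (hd r) → SNArgs-∷ (hW r) (acc hWs) ; (tl rs) → SNArgs-∷ (acc hW) (hWs rs) }

  allSN⇒SNArgs : ∀ {Γ Ξ} {Ws : Args Γ Ξ} → AllArgs SN Ws → SNArgs Ws
  allSN⇒SNArgs []       = acc λ ()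
  allSN⇒SNArgs (s ∷ ss) = SNArgs-∷ s (allSN⇒SNArgs ss)

  allSN-→cᵃ : ∀ {Γ Ξ} {Ws Ws' : Args Γ Ξ} → AllArgs SN Ws → Ws →cᵃ Ws' → AllArgs SN Ws'
  allSN-→cᵃ (s ∷ ss) (hd r)  = SN-→c s r ∷ ss
  allSN-→cᵃ (s ∷ ss) (tl rs) = s ∷ allSN-→cᵃ ss rs

  SN-box⇒allSN : ∀ {Γ Ξ τ} (Ns : Args Γ Ξ) {B : Tm Ξ τ} {v : Value B} → SN (box Ns B v) → AllArgs SN Ns
  SN-box⇒allSN Ns {B} {v} = go (λ Xs → box Xs B v) ξ-box-arg Ns
    where
    go : ∀ {Γ Γ' Ξ τ} (f : Args Γ Ξ → Tm Γ' τ) → (∀ {Ms Ns} → Ms →cᵃ Ns → f Ms →c f Ns) →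
         (Ns : Args Γ Ξ) → SN (f Ns) → AllArgs SN Ns
    go f f-→c []       s = []
    go f f-→c (N ∷ Ns) s =
      SN-map⁻ (λ t → f (t ∷ Ns)) (f-→c ∘ hd) s ∷ go (λ Xs → f (N ∷ Xs)) (f-→c ∘ tl) Ns s

  boxNodes : ∀ {Γ τ} → Tm Γ (□ τ) → ℕ
  boxNodesArgs : ∀ {Γ Ξ} → Args Γ Ξ → ℕ
  boxNodes (box Ns B v) = suc (boxNodesArgs Ns)
  boxNodes _            = 0
  boxNodesArgs []       = 0
  boxNodesArgs (N ∷ Ns) = boxNodes N + boxNodesArgs Ns

  boxNodesArgs-++ : ∀ {Γ Ξ₁ Ξ₂} (Xs : Args Γ Ξ₁) (Ys : Args Γ Ξ₂) →
                    boxNodesArgs (Xs ++ᵃ Ys) ≡ boxNodesArgs Xs + boxNodesArgs Ys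
  boxNodesArgs-++ []       Ys = refl
  boxNodesArgs-++ (X ∷ Xs) Ys =
    trans (cong (boxNodes X +_) (boxNodesArgs-++ Xs Ys)) (sym (+-assoc (boxNodes X) (boxNodesArgs Xs) (boxNodesArgs Ys)))

  boxNodesArgs-merge : ∀ {Γ Δw Δy Δz σ} (Ws : Args Γ Δw) (Ns : Args Γ Δy) {V : Tm Δy σ} {vV : Value V}
                       (Ps : Args Γ Δz) →
                       boxNodesArgs (Ws ++ᵃ (Ns ++ᵃ Ps)) < boxNodesArgs (Ws ++ᵃ (box Ns V vV ∷ Ps))
  boxNodesArgs-merge Ws Ns {V} {vV} Ps
    rewrite boxNodesArgs-++ Ws (Ns ++ᵃ Ps) | boxNodesArgs-++ Ws (box Ns V vV ∷ Ps) | boxNodesArgs-++ Ns Ps =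
    +-mono-≤-< (≤-refl {boxNodesArgs Ws}) (n<1+n _)

  boxNodes-→c : ∀ {Γ τ} {V V' : Tm Γ (□ τ)} → Value V → V →c V' → boxNodes V' ≤ boxNodes V
  boxNodesArgs-→cᵃ : ∀ {Γ Ξ} {Ws Ws' : Args Γ Ξ} → Values Ws → Ws →cᵃ Ws' → boxNodesArgs Ws' ≤ boxNodesArgs Ws
  boxNodes-→c (vbox ws) (lift-box {Vs = Vs} _ ¬a) with values-++⁻ Vs ws
  ... | _ , (a ∷ _) = ⊥-elim (¬a a)
  boxNodes-→c (vbox ws) (box-var {M = M}) = ≤-trans (m≤m+n (boxNodes M) 0) (n≤1+n _)
  boxNodes-→c (vbox ws) (box-merge {Ws = Ws} {Ns = Ns} {Ps = Ps} _) = <⇒≤ (s≤s (boxNodesArgs-merge Ws Ns Ps))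
  boxNodes-→c (vbox ws) (ξ-box-arg rs)  = s≤s (boxNodesArgs-→cᵃ ws rs)
  boxNodes-→c (vbox ws) (ξ-box-body r)  = ≤-refl
  boxNodesArgs-→cᵃ (w ∷ ws) (hd r) = +-mono-≤ (boxNodes-→c w r) ≤-refl
  boxNodesArgs-→cᵃ {Ws = W ∷ _} (w ∷ ws) (tl rs) = +-mono-≤ (≤-refl {boxNodes W}) (boxNodesArgs-→cᵃ ws rs)

  -- By induction on the number of box nodes, then on the arguments, then on the realisation.
  SN-box-value : ∀ {n} → Acc _<_ n → ∀ {Γ Ξ} {Ws : Args Γ Ξ} → SNArgs Ws → AllArgs SN Ws → boxNodesArgs Ws ≤ n →
                 ∀ {Θ τ} {B : Tm Ξ τ} {v : Value B} {U : Tm Θ τ} → Real (box Ws B v) U → SN U → SN (box Ws B v)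
  box-value-step : ∀ {n} → Acc _<_ n → ∀ {Γ Ξ} {Ws : Args Γ Ξ} → SNArgs Ws → AllArgs SN Ws → boxNodesArgs Ws ≤ n →
                   ∀ {Θ τ} {B : Tm Ξ τ} {v : Value B} {U : Tm Θ τ} → Real (box Ws B v) U → SN U →
                   ∀ {Y} → box Ws B v →c Y → SN Y

  SN-box-value a sa ss le real snU = acc (box-value-step a sa ss le real snU)

  box-value-step a sa ss le (rbox ra e) (acc hU) (ξ-box-body r) =
    SN-box-value a sa ss le (rbox ra refl) (hU (subst₂ _→c_ (sym e) refl (sub-→c (realArgs-value ra) r)))
  box-value-step a (acc hA) ss le real@(rbox ra _) snU (ξ-box-arg rs) with real-→c (ξ-box-arg rs) real
  ... | _ , real' , q = SN-box-value a (hA rs) (allSN-→cᵃ ss rs)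
                                     (≤-trans (boxNodesArgs-→cᵃ (realArgs-values⁻ ra) rs) le) real' (SN-→* snU q)
  box-value-step a sa (s ∷ []) le real snU box-var = s
  box-value-step a sa ss le (rbox ra e) snU (lift-box {Vs = Vs} _ ¬a) with realArgs-split Vs ra
  ... | _ , rcons r _ = ⊥-elim (¬a (real-value⁻ r))
  box-value-step (acc rs) sa ss le real snU (box-merge {Ws = Ws} {Ns = Ns} {vV = vV} {Ps = Ps} ws)
    with real-→c (box-merge {vV = vV} ws) real | allArgs-++⁻ Ws ss
  ... | _ , real' , q | sW , (sB ∷ sP) =
    SN-box-value (rs (<-≤-trans (boxNodesArgs-merge Ws Ns Ps) le)) (allSN⇒SNArgs ss') ss' ≤-refl real'
                 (SN-→* snU q)
    where
    ss' : AllArgs SN (Ws ++ᵃ (Ns ++ᵃ Ps))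
    ss' = allArgs-++ sW (allArgs-++ (SN-box⇒allSN Ns sB) sP)

  -- Reducibility

  RenSN : ∀ {Γ σ} → Tm Γ σ → Set
  RenSN {Γ} M = ∀ {Δ} (ρ : Ren Γ Δ) → SN (ren ρ M)

  RedVal   : (σ : Ty) → ∀ {Γ} → Tm Γ σ → Set
  RedTm    : (σ : Ty) → ∀ {Γ} → Tm Γ σ → Set
  RedStack : (σ : Ty) → ∀ {Γ τ} → Stack Γ σ τ → Set
  RedVal (atom n) V     = RenSN V
  RedVal (σ ⊃ τ) {Γ} V = ∀ {Δ} (ρ : Ren Γ Δ) {W : Tm Δ σ} → Value W → RedVal σ W → RedTm τ (app (ren ρ V) W)
  RedVal (□ τ) V        = RenSN V × (∀ {Θ} {U : Tm Θ τ} → Real V U → RedVal τ U)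
  RedStack σ {Γ} S = ∀ {Δ} (ρ : Ren Γ Δ) {V : Tm Δ σ} → Value V → RedVal σ V → SN (plug (renStack ρ S) V)
  RedTm σ {Γ} M    = ∀ {Δ τ} (ρ : Ren Γ Δ) (S : Stack Δ σ τ) → RedStack σ S → SN (plug S (ren ρ M))

  RenSN-ren : ∀ {Γ Δ σ} {M : Tm Γ σ} (ρ : Ren Γ Δ) → RenSN M → RenSN (ren ρ M)
  RenSN-ren {M = M} ρ f ρ' = subst SN (sym (ren-∘ ρ' ρ M)) (f _)

  RedVal-ren : ∀ σ {Γ Δ} {V : Tm Γ σ} (ρ : Ren Γ Δ) → RedVal σ V → RedVal σ (ren ρ V)
  RedVal-ren (atom n)          ρ f        = RenSN-ren ρ f
  RedVal-ren (σ ⊃ τ) {V = V} ρ f ρ' w rw = subst (λ m → RedTm τ (app m _)) (sym (ren-∘ ρ' ρ V)) (f _ w rw)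
  RedVal-ren (□ τ)   {V = V} ρ (f , g)  = RenSN-ren ρ f , (g ∘ real-ren⁻ ρ V)

  RedTm-ren : ∀ σ {Γ Δ} {M : Tm Γ σ} (ρ : Ren Γ Δ) → RedTm σ M → RedTm σ (ren ρ M)
  RedTm-ren σ {M = M} ρ f ρ' S s = subst (SN ∘ plug S) (sym (ren-∘ ρ' ρ M)) (f _ S s)

  RedStack-ren : ∀ σ {Γ Δ τ} {S : Stack Γ σ τ} (ρ : Ren Γ Δ) → RedStack σ S → RedStack σ (renStack ρ S)
  RedStack-ren σ {S = S} ρ f ρ' v rv = subst (λ s → SN (plug s _)) (sym (renStack-∘ ρ' ρ S)) (f _ v rv)

  SN-plug-ren-id : ∀ {Γ σ τ} (S : Stack Γ σ τ) {M : Tm Γ σ} → SN (plug S (ren (λ x → x) M)) → SN (plug S M)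
  SN-plug-ren-id S {M} = subst (SN ∘ plug S) (ren-id M)

  RedVal⇒RedTm : ∀ σ {Γ} {V : Tm Γ σ} → Value V → RedVal σ V → RedTm σ V
  RedVal⇒RedTm σ {V = V} v rv ρ S s =
    subst (λ S → SN (plug S (ren ρ V))) (renStack-id S) (s (λ x → x) (ren-value ρ v) (RedVal-ren σ ρ rv))

  RedVal⇒SN : ∀ σ {Γ} {V : Tm Γ σ} → RedVal σ V → SN V
  RedTm⇒SN : ∀ σ {Γ} {M : Tm Γ σ} → RedTm σ M → SN M
  head-RedVal : ∀ σ {Γ} {H : Tm Γ σ} → Head H → RedVal σ H
  RedStack⇒SNStack : ∀ σ {Γ τ} {S : Stack Γ σ τ} → RedStack σ S → SNStack S

  RedTm⇒SN σ f = SN-ren⁻ (λ x → x) (f (λ x → x) ε (λ ρ v rv → RedVal⇒SN σ rv))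

  RedVal⇒SN (atom n) f       = SN-ren⁻ (λ x → x) (f (λ x → x))
  RedVal⇒SN (□ τ)    (f , g) = SN-ren⁻ (λ x → x) (f (λ x → x))
  RedVal⇒SN (σ ⊃ τ)  f       =
    SN-ren⁻ there (SN-map⁻ (λ m → app m (var here)) ξ-appˡ (RedTm⇒SN τ (f there vvar (head-RedVal σ var))))

  -- plug S x  is strongly normalising for a fresh x, and  x  is a non-value once let-bound.
  RedStack⇒SNStack σ {S = S} s =
    SNStack-ren⁻ there (SN-plug⇒SNStack (renStack there S) (lett (var here) (var here)) (λ ())
      (SN-expand-let-val (<-wellFounded _) vvar (SN-head var) (s there vvar (head-RedVal σ var))
                         (renStack there S) ≤-refl refl))

  head-RedVal (atom n) h ρ = SN-head (ren-head ρ h)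
  head-RedVal (□ τ)    h   =
    (λ ρ → SN-head (ren-head ρ h)) , λ { rvar → head-RedVal τ var ; rcon → head-RedVal τ var }
  head-RedVal (σ ⊃ τ)  h ρ w rw ρ' S s =
    SN-neutral-app (ren-head ρ' (ren-head ρ h)) {S = S} (RedStack⇒SNStack τ s)
                   (ren-value ρ' w) (RedVal⇒SN σ (RedVal-ren σ ρ' rw))

  SN-plug-app-value : ∀ {Γ σ τ ρ} {V : Tm Γ (σ ⊃ τ)} {N : Tm Γ σ} → Value V → RedVal (σ ⊃ τ) V → RedTm σ N →
                      (S : Stack Γ τ ρ) → RedStack τ S → SN (plug S (app V N))
  SN-plug-app-value {σ = σ} {τ} {V = V} {N} v rv rN S s =
    SN-expand-lift-appʳ S V N v (SN-plug-ren-id (F ▷ S) (rN (λ x → x) (F ▷ S) s')) refl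
    where
    F : Frame _ σ τ
    F = letF (app (wk V) (var here))
    s' : RedStack σ (F ▷ S)
    s' ρ' {W} w rw = SN-expand-let-val (<-wellFounded _) w (RedVal⇒SN σ rw)
      (SN-plug-ren-id (renStack ρ' S) (rv ρ' w rw (λ x → x) (renStack ρ' S) (RedStack-ren τ {S = S} ρ' s)))
      (renStack ρ' S) ≤-refl (cong (λ m → plug (renStack ρ' S) (app m W)) (sym (liftR-wk-[] ρ' V W)))

  RedTm-app : ∀ {Γ σ τ} {M : Tm Γ (σ ⊃ τ)} {N : Tm Γ σ} → RedTm (σ ⊃ τ) M → RedTm σ N → RedTm τ (app M N)
  RedTm-app {σ = σ} {τ} {M} {N} rM rN ρ S s =
    SN-expand-lift-appˡ S (ren ρ M) (ren ρ N) (rM ρ (letF (app (var here) (wk (ren ρ N))) ▷ S) s') refl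
    where
    s' : RedStack (σ ⊃ τ) (letF (app (var here) (wk (ren ρ N))) ▷ S)
    s' ρ' {V} v rv = SN-expand-let-val (<-wellFounded _) v (RedVal⇒SN (σ ⊃ τ) rv)
      (SN-plug-app-value v rv (RedTm-ren σ ρ' (RedTm-ren σ ρ rN)) (renStack ρ' S) (RedStack-ren τ {S = S} ρ' s))
      (renStack ρ' S) ≤-refl (cong (λ n → plug (renStack ρ' S) (app V n)) (sym (liftR-wk-[] ρ' (ren ρ N) V)))

  RedBinder : (σ τ : Ty) → ∀ {Γ} → Tm (σ ∷ Γ) τ → Set
  RedBinder σ τ {Γ} M = ∀ {Δ} (ρ : Ren Γ Δ) {W : Tm Δ σ} → Value W → RedVal σ W → RedTm τ (ren (liftR ρ) M [ W ])

  RedTm-lett : ∀ {Γ σ τ} {N : Tm Γ σ} {M : Tm (σ ∷ Γ) τ} → RedTm σ N → RedBinder σ τ M → RedTm τ (lett N M)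
  RedTm-lett {σ = σ} {τ} {M = M} rN rM ρ S s = rN ρ (letF (ren (liftR ρ) M) ▷ S) s'
    where
    s' : RedStack σ (letF (ren (liftR ρ) M) ▷ S)
    s' ρ' {V} v rv = SN-expand-let-val (<-wellFounded _) v (RedVal⇒SN σ rv)
      (SN-plug-ren-id (renStack ρ' S) (rM (ρ' ∘ ρ) v rv (λ x → x) (renStack ρ' S) (RedStack-ren τ {S = S} ρ' s)))
      (renStack ρ' S) ≤-refl (cong (plug (renStack ρ' S)) (sym (liftR-[] ρ' ρ M V)))

  RedVal-lam : ∀ {Γ σ τ} {B : Tm (σ ∷ Γ) τ} → RedBinder σ τ B → RedVal (σ ⊃ τ) (lam B)
  RedVal-lam {σ = σ} {B = B} rB ρ {W} w rw ρ' S s =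
    SN-expand-β (<-wellFounded _) S ≤-refl (ren (liftR ρ') (ren (liftR ρ) B)) (ren ρ' W) (ren-value ρ' w)
      (RedVal⇒SN σ (RedVal-ren σ ρ' rw))
      (SN-plug-ren-id S (rB (ρ' ∘ ρ) (ren-value ρ' w) (RedVal-ren σ ρ' rw) (λ x → x) S s))
      (cong (plug S) (sym (liftR-[] ρ' ρ B (ren ρ' W))))

  RedVal□ : ∀ {Γ σ} → Tm Γ (□ σ) → Set
  RedVal□ {σ = σ} = RedVal (□ σ)

  RedTm□ : ∀ {Γ σ} → Tm Γ (□ σ) → Set
  RedTm□ {σ = σ} = RedTm (□ σ)

  RedSub : ∀ {Γ Θ} → Sub Γ Θ → Set
  RedSub {Γ} s = ∀ {σ} (x : Γ ∋ σ) → RedVal σ (s x)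

  RedBody : ∀ {Ξ τ} → Tm Ξ τ → Set
  RedBody {Ξ} {τ} B = ∀ {Θ} (s : Sub Ξ Θ) → ValueSub s → RedSub s → RedVal τ (sub s B)

  realArgs-RedSub : ∀ {Γ Θ Ξ} {Ws : Args Γ Ξ} {s : Sub Ξ Θ} → RealArgs Ws s → AllArgs RedVal□ Ws → RedSub s
  realArgs-RedSub (rcons r ra) (rv ∷ _)  here      = proj₂ rv r
  realArgs-RedSub (rcons r ra) (_ ∷ rvs) (there x) = realArgs-RedSub ra rvs x

  allRedVal⇒allSN : ∀ {Γ Δ Ξ} (ρ : Ren Γ Δ) {Ws : Args Γ Ξ} → AllArgs RedVal□ Ws → AllArgs SN (renArgs ρ Ws)
  allRedVal⇒allSN ρ []         = []
  allRedVal⇒allSN ρ (rv ∷ rvs) = proj₁ rv ρ ∷ allRedVal⇒allSN ρ rvs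

  RedVal-box : ∀ {Γ Ξ τ} {Ws : Args Γ Ξ} {B : Tm Ξ τ} {v : Value B} → Values Ws → AllArgs RedVal□ Ws → RedBody B →
               RedVal (□ τ) (box Ws B v)
  RedVal-box {τ = τ} {Ws} {B} {v} ws rvs rB = SN-ren , RedVal-real
    where
    RedVal-real : ∀ {Θ} {U : Tm Θ τ} → Real (box Ws B v) U → RedVal τ U
    RedVal-real (rbox ra e) = subst (RedVal τ) (sym e) (rB _ (realArgs-value ra) (realArgs-RedSub ra rvs))
    SN-ren : RenSN (box Ws B v)
    SN-ren ρ with realise (ren-value ρ (vbox {v = v} ws))
    ... | _ , _ , r = SN-box-value (<-wellFounded _) (allSN⇒SNArgs (allRedVal⇒allSN ρ rvs)) (allRedVal⇒allSN ρ rvs)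
                                   ≤-refl r (RedVal⇒SN τ (RedVal-real (real-ren⁻ ρ (box Ws B v) r)))

  data ValuePrefix (Γ : Ctx) : Ctx → Ctx → Set where
    pnil  : ∀ {Δ} → ValuePrefix Γ Δ Δ
    pcons : ∀ {σ Δ₂ Δ} (W : Tm Γ (□ σ)) → Value W → ValuePrefix Γ Δ₂ Δ → ValuePrefix Γ Δ₂ (σ ∷ Δ)

  infixr 5 _++ᵖ_ _++ʰ_
  _++ᵖ_ : ∀ {Γ Δ₂ Δ} → ValuePrefix Γ Δ₂ Δ → Args Γ Δ₂ → Args Γ Δ
  pnil          ++ᵖ Ms = Ms
  pcons W w P ++ᵖ Ms = W ∷ (P ++ᵖ Ms)

  _++ʰ_ : ∀ {Γ Δ₂ Δ ρ} → ValuePrefix Γ Δ₂ Δ → ArgsHole Γ Δ₂ ρ → ArgsHole Γ Δ ρ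
  pnil          ++ʰ H = H
  pcons W w P ++ʰ H = cons W w (P ++ʰ H)

  snoc : ∀ {Γ σ Δ₂ Δ} → ValuePrefix Γ (σ ∷ Δ₂) Δ → (W : Tm Γ (□ σ)) → Value W → ValuePrefix Γ Δ₂ Δ
  snoc pnil          W w = pcons W w pnil
  snoc (pcons V v P) W w = pcons V v (snoc P W w)

  renPrefix : ∀ {Γ Θ Δ₂ Δ} → Ren Γ Θ → ValuePrefix Γ Δ₂ Δ → ValuePrefix Θ Δ₂ Δ
  renPrefix ρ pnil          = pnil
  renPrefix ρ (pcons W w P) = pcons (ren ρ W) (ren-value ρ w) (renPrefix ρ P)

  fill-++ʰ : ∀ {Γ Δ₂ Δ ρ} (P : ValuePrefix Γ Δ₂ Δ) (H : ArgsHole Γ Δ₂ ρ) (X : Tm Γ (□ ρ)) →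
             fill (P ++ʰ H) X ≡ P ++ᵖ fill H X
  fill-++ʰ pnil          H X = refl
  fill-++ʰ (pcons W w P) H X = cong (W ∷_) (fill-++ʰ P H X)

  snoc-++ᵖ : ∀ {Γ σ Δ₂ Δ} (P : ValuePrefix Γ (σ ∷ Δ₂) Δ) (W : Tm Γ (□ σ)) (w : Value W) (Ms : Args Γ Δ₂) →
             snoc P W w ++ᵖ Ms ≡ P ++ᵖ (W ∷ Ms)
  snoc-++ᵖ pnil          W w Ms = refl
  snoc-++ᵖ (pcons V v P) W w Ms = cong (V ∷_) (snoc-++ᵖ P W w Ms)

  renArgs-++ᵖ : ∀ {Γ Θ Δ₂ Δ} (ρ : Ren Γ Θ) (P : ValuePrefix Γ Δ₂ Δ) (Ms : Args Γ Δ₂) →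
                renArgs ρ (P ++ᵖ Ms) ≡ renPrefix ρ P ++ᵖ renArgs ρ Ms
  renArgs-++ᵖ ρ pnil          Ms = refl
  renArgs-++ᵖ ρ (pcons W w P) Ms = cong (ren ρ W ∷_) (renArgs-++ᵖ ρ P Ms)

  renHole-++ʰ : ∀ {Γ Θ Δ₂ Δ ρ'} (ρ : Ren Γ Θ) (P : ValuePrefix Γ Δ₂ Δ) (H : ArgsHole Γ Δ₂ ρ') →
                renHole ρ (P ++ʰ H) ≡ renPrefix ρ P ++ʰ renHole ρ H
  renHole-++ʰ ρ pnil          H = refl
  renHole-++ʰ ρ (pcons W w P) H = cong (cons (ren ρ W) (ren-value ρ w)) (renHole-++ʰ ρ P H)

  data RedPrefix {Γ} : ∀ {Δ₂ Δ} → ValuePrefix Γ Δ₂ Δ → Set where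
    pnil  : ∀ {Δ} → RedPrefix (pnil {Δ = Δ})
    pcons : ∀ {σ Δ₂ Δ} {W : Tm Γ (□ σ)} {w : Value W} {P : ValuePrefix Γ Δ₂ Δ} →
            RedVal□ W → RedPrefix P → RedPrefix (pcons W w P)

  RedPrefix-ren : ∀ {Γ Θ Δ₂ Δ} (ρ : Ren Γ Θ) {P : ValuePrefix Γ Δ₂ Δ} → RedPrefix P → RedPrefix (renPrefix ρ P)
  RedPrefix-ren ρ pnil          = pnil
  RedPrefix-ren ρ (pcons rv rp) = pcons (RedVal-ren (□ _) ρ rv) (RedPrefix-ren ρ rp)

  RedPrefix-snoc : ∀ {Γ σ Δ₂ Δ} {P : ValuePrefix Γ (σ ∷ Δ₂) Δ} → RedPrefix P → {W : Tm Γ (□ σ)} {w : Value W} →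
                   RedVal□ W → RedPrefix (snoc P W w)
  RedPrefix-snoc pnil           rw = pcons rw pnil
  RedPrefix-snoc (pcons rv rp) rw = pcons rv (RedPrefix-snoc rp rw)

  RedPrefix-complete : ∀ {Γ Δ} {P : ValuePrefix Γ [] Δ} → RedPrefix P →
                       Values (P ++ᵖ []) × AllArgs RedVal□ (P ++ᵖ [])
  RedPrefix-complete pnil = [] , []
  RedPrefix-complete {P = pcons W w P} (pcons rv rp) =
    let (vs , rvs) = RedPrefix-complete rp in (w ∷ vs) , (rv ∷ rvs)

  allRedTm-ren : ∀ {Γ Θ Ξ} (ρ : Ren Γ Θ) {Ms : Args Γ Ξ} → AllArgs RedTm□ Ms → AllArgs RedTm□ (renArgs ρ Ms)
  allRedTm-ren ρ []         = []
  allRedTm-ren ρ (rM ∷ rMs) = RedTm-ren (□ _) ρ rM ∷ allRedTm-ren ρ rMs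

  -- The arguments are evaluated from left to right: the stack frame around the next
  -- argument is reducible because, once it is a value, it joins the value prefix.
  RedTm-box : ∀ {Γ τ} Δ₂ {Δ} (P : ValuePrefix Γ Δ₂ Δ) → RedPrefix P → (Ms : Args Γ Δ₂) → AllArgs RedTm□ Ms →
              {B : Tm Δ τ} (v : Value B) → RedBody B → RedTm (□ τ) (box (P ++ᵖ Ms) B v)
  RedTm-box [] P rp [] [] v rB =
    let (vs , rvs) = RedPrefix-complete rp in RedVal⇒RedTm (□ _) (vbox vs) (RedVal-box vs rvs rB)
  RedTm-box {τ = τ} (σ ∷ Δ₂) {Δ} P rp (M ∷ Ms) (rM ∷ rMs) {B} v rB ρ S s =
    subst (λ Xs → SN (plug S (box Xs B v))) (sym ren-args) (rM ρ (boxF H B v ▷ S) s')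
    where
    H : ArgsHole _ Δ σ
    H = renPrefix ρ P ++ʰ hole (renArgs ρ Ms)
    ren-args : renArgs ρ (P ++ᵖ (M ∷ Ms)) ≡ fill H (ren ρ M)
    ren-args = trans (renArgs-++ᵖ ρ P (M ∷ Ms)) (sym (fill-++ʰ (renPrefix ρ P) (hole (renArgs ρ Ms)) (ren ρ M)))
    s' : RedStack (□ σ) (boxF H B v ▷ S)
    s' ρ' {W} w rw =
      subst (λ Xs → SN (plug (renStack ρ' S) (box Xs B v))) snoc-args
        (SN-plug-ren-id (renStack ρ' S)
          (RedTm-box Δ₂ (snoc (renPrefix ρ' (renPrefix ρ P)) W w)
                     (RedPrefix-snoc (RedPrefix-ren ρ' (RedPrefix-ren ρ rp)) rw)
                     (renArgs ρ' (renArgs ρ Ms)) (allRedTm-ren ρ' (allRedTm-ren ρ rMs)) v rB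
                     (λ x → x) (renStack ρ' S) (RedStack-ren (□ τ) {S = S} ρ' s)))
      where
      snoc-args : snoc (renPrefix ρ' (renPrefix ρ P)) W w ++ᵖ renArgs ρ' (renArgs ρ Ms) ≡ fill (renHole ρ' H) W
      snoc-args = trans (snoc-++ᵖ _ W w _)
        (trans (sym (fill-++ʰ (renPrefix ρ' (renPrefix ρ P)) (hole (renArgs ρ' (renArgs ρ Ms))) W))
               (cong (λ h → fill h W) (sym (renHole-++ʰ ρ' (renPrefix ρ P) (hole (renArgs ρ Ms))))))

  -- The fundamental lemma

  ren∘sub-[] : ∀ {Γ Δ Θ σ τ} (s : Sub Γ Δ) (ρ : Ren Δ Θ) (M : Tm (σ ∷ Γ) τ) (W : Tm Θ σ) →
               ren (liftR ρ) (sub (liftS s) M) [ W ] ≡ sub (W ∷ˢ ren ρ ∘ s) M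
  ren∘sub-[] s ρ M W = trans (cong (_[ W ]) (ren-sub (liftR ρ) (liftS s) M))
    (trans (sub-∘ (single W) _ M) (sub-cong (λ { here → refl ; (there x) → liftR-wk-[] ρ (s x) W }) M))

  ∷ˢ-value : ∀ {Γ Δ Θ σ} {s : Sub Γ Δ} (ρ : Ren Δ Θ) {W : Tm Θ σ} → ValueSub s → Value W →
             ValueSub (W ∷ˢ ren ρ ∘ s)
  ∷ˢ-value ρ vs w here      = w
  ∷ˢ-value ρ vs w (there x) = ren-value ρ (vs x)

  ∷ˢ-RedSub : ∀ {Γ Δ Θ σ} {s : Sub Γ Δ} (ρ : Ren Δ Θ) {W : Tm Θ σ} → RedSub s → RedVal σ W →
              RedSub (W ∷ˢ ren ρ ∘ s)
  ∷ˢ-RedSub ρ rs rw here      = rw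
  ∷ˢ-RedSub ρ rs rw (there x) = RedVal-ren _ ρ (rs x)

  fundamental : ∀ {Γ σ} (M : Tm Γ σ) {Θ} (s : Sub Γ Θ) → ValueSub s → RedSub s → RedTm σ (sub s M)
  fundamental-value : ∀ {Γ σ} (M : Tm Γ σ) → Value M → ∀ {Θ} (s : Sub Γ Θ) → ValueSub s → RedSub s →
                      RedVal σ (sub s M)
  fundamental-args : ∀ {Γ Ξ} (Ns : Args Γ Ξ) {Θ} (s : Sub Γ Θ) → ValueSub s → RedSub s →
                     AllArgs RedTm□ (subArgs s Ns)
  fundamental-values : ∀ {Γ Ξ} (Ns : Args Γ Ξ) → Values Ns → ∀ {Θ} (s : Sub Γ Θ) → ValueSub s → RedSub s →
                       AllArgs RedVal□ (subArgs s Ns)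
  fundamental-binder : ∀ {Γ σ τ} (M : Tm (σ ∷ Γ) τ) {Θ} (s : Sub Γ Θ) → ValueSub s → RedSub s →
                       RedBinder σ τ (sub (liftS s) M)

  fundamental (con c)      s vs rs = RedVal⇒RedTm _ vcon (head-RedVal _ con)
  fundamental (var x)      s vs rs = RedVal⇒RedTm _ (vs x) (rs x)
  fundamental (lam M)      s vs rs = RedVal⇒RedTm _ vlam (fundamental-value (lam M) vlam s vs rs)
  fundamental (app M N)    s vs rs = RedTm-app (fundamental M s vs rs) (fundamental N s vs rs)
  fundamental (box Ns B v) s vs rs =
    RedTm-box _ pnil pnil (subArgs s Ns) (fundamental-args Ns s vs rs) v (fundamental-value B v)
  fundamental (lett N M)   s vs rs = RedTm-lett (fundamental N s vs rs) (fundamental-binder M s vs rs)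

  fundamental-value (con c)      _         s vs rs = head-RedVal _ con
  fundamental-value (var x)      _         s vs rs = rs x
  fundamental-value (lam M)      _         s vs rs = RedVal-lam (fundamental-binder M s vs rs)
  fundamental-value (box Ns B v) (vbox ns) s vs rs =
    RedVal-box (sub-values vs ns) (fundamental-values Ns ns s vs rs) (fundamental-value B v)

  fundamental-args []       s vs rs = []
  fundamental-args (N ∷ Ns) s vs rs = fundamental N s vs rs ∷ fundamental-args Ns s vs rs

  fundamental-values []       []       s vs rs = []
  fundamental-values (N ∷ Ns) (n ∷ ns) s vs rs = fundamental-value N n s vs rs ∷ fundamental-values Ns ns s vs rs

  fundamental-binder {τ = τ} M s vs rs ρ {W} w rw =
    subst (RedTm τ) (sym (ren∘sub-[] s ρ M W))
          (fundamental M (W ∷ˢ ren ρ ∘ s) (∷ˢ-value ρ vs w) (∷ˢ-RedSub ρ rs rw))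

  SN-all : ∀ {Γ σ} (M : Tm Γ σ) → SN M
  SN-all M = subst SN (sub-id M) (RedTm⇒SN _ (fundamental M var (λ _ → vvar) (λ _ → head-RedVal _ var)))

  SN⇒no-infinite-reduction : ∀ {Γ σ} (f : ℕ → Tm Γ σ) (n : ℕ) → SN (f n) → ¬ (∀ k → f k →c f (suc k))
  SN⇒no-infinite-reduction f n (acc h) steps = SN⇒no-infinite-reduction f (suc n) (h (steps n)) steps

open StrongNormalisation using (SN-all; SN⇒no-infinite-reduction)

proposition11 : (K : Ty → Set) {Γ : Ctx} {σ : Ty} (M : D.Tm K Γ σ) →
    ¬ (Σ (ℕ → D.Tm K Γ σ) (λ f → (f 0 ≡ M) × ((n : ℕ) → D._→c_ K (f n) (f (suc n)))))
proposition11 K M (f , refl , steps) = SN⇒no-infinite-reduction K f 0 (SN-all K M) steps
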